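{- Let $q$ be a prime power, $n\ge 2$, let $U_{q,n}=\{\alpha\in\mathbb{F}_{q^n}:\mathrm{Tr}_n(\alpha)=0\}$, and let $U\subsetneq\mathbb{F}_{q^n}$ be an $\mathbb{F}_q$-vector space of dimension $n-1$. Then: (1) If $q$ is even or $qn$ is odd, there exists $a\neq 0$ such that $U=a^2U_{q,n}$; in this case the graphs $G_U$ and $G_{U_{q,n}}$ are isomorphic. (2) If $q$ is odd and $n$ is even, there exists a non-square $\lambda\in\mathbb{F}_{q^n}^*$ (not depending on $U$) such that $U=a^2\varepsilon U_{q,n}$ for some $a\neq 0$ and $\varepsilon\in\{1,\lambda\}$; in this case the graphs $G_U$ and $G_{\varepsilon U_{q,n}}$ are isomorphic.
   Context: $\mathrm{Tr}_n(a)=\sum_{i=0}^{n-1}a^{q^i}$ is the trace from $\mathbb{F}_{q^n}$ to $\mathbb{F}_q$. For an $\mathbb{F}_q$-vector subspace $V\subsetneq\mathbb{F}_{q^n}$, $G_V$ is the undirected graph with vertex set $\mathbb{F}_{q^n}$ in which distinct $a,b$ are adjacent if and only if $ab\in V$. Squares/non-squares refer to $\mathbb{F}_{q^n}$. -}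

module Defs where

open import Level using (0ℓ)
open import Data.Nat as ℕ using (ℕ; zero; suc)
open import Data.Fin using (Fin; zero; suc)
open import Data.List using (List; length)
open import Data.List.Membership.Propositional using (_∈_)
open import Data.List.Relation.Unary.Unique.Propositional using (Unique)
open import Data.Product using (Σ; ∃; ∃-syntax; _×_; _,_)
open import Data.Sum using (_⊎_)
open import Relation.Nullary using (¬_)
open import Relation.Unary using (Pred)
open import Relation.Binary.PropositionalEquality using (_≡_; _≢_)
open import Algebra.Structures using (IsCommutativeRing)
open import Function.Definitions using (Bijective)
open import Function.Bundles using (_⇔_)

record FiniteField : Set₁ where
  infixl 7 _*_
  infixl 6 _+_
  field
    Carrier : Set
    _+_ _*_ : Carrier → Carrier → Carrier
    -_      : Carrier → Carrier
    0# 1#   : Carrier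
    isCommutativeRing : IsCommutativeRing _≡_ _+_ _*_ -_ 0# 1#
    0≢1     : 0# ≢ 1#
    inverse : ∀ x → x ≢ 0# → ∃[ y ] (x * y ≡ 1#)
    elements          : List Carrier
    elements-unique   : Unique elements
    elements-complete : ∀ x → x ∈ elements

  order : ℕ
  order = length elements

  _^_ : Carrier → ℕ → Carrier
  x ^ zero  = 1#
  x ^ suc m = x * (x ^ m)

  ∑ : (m : ℕ) → (Fin m → Carrier) → Carrier
  ∑ zero    f = 0#
  ∑ (suc m) f = f zero + ∑ m (λ i → f (suc i))

  -- Setting: the field is F_{q^n}.  The subfield F_q = {x | x^q = x}.
  InFq : ℕ → Pred Carrier 0ℓ
  InFq q x = x ^ q ≡ x

  Tr : (q n : ℕ) → Carrier → Carrier
  Tr q n a = ∑ n (λ i → a ^ (q ℕ.^ Data.Fin.toℕ i))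

  Uqn : (q n : ℕ) → Pred Carrier 0ℓ
  Uqn q n x = Tr q n x ≡ 0#

  record IsSubspace (q : ℕ) (V : Pred Carrier 0ℓ) : Set where
    field
      zero-closed  : V 0#
      +-closed     : ∀ {x y} → V x → V y → V (x + y)
      scal-closed  : ∀ {c x} → InFq q c → V x → V (c * x)

  HasDim : (q : ℕ) → Pred Carrier 0ℓ → ℕ → Set
  HasDim q V m = Σ (Fin m → Carrier) λ b →
    (∀ (c : Fin m → Carrier) → (∀ i → InFq q (c i)) →
       ∑ m (λ i → c i * b i) ≡ 0# → ∀ i → c i ≡ 0#)
    × (∀ x → V x ⇔ (Σ (Fin m → Carrier) λ c → (∀ i → InFq q (c i)) × x ≡ ∑ m (λ i → c i * b i)))

  scale : Carrier → Pred Carrier 0ℓ → Pred Carrier 0ℓ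
  scale s W x = Σ Carrier λ y → (W y × x ≡ s * y)

  _≐_ : Pred Carrier 0ℓ → Pred Carrier 0ℓ → Set
  V ≐ W = ∀ x → V x ⇔ W x

  Adj : Pred Carrier 0ℓ → Carrier → Carrier → Set
  Adj V a b = a ≢ b × V (a * b)

  GraphIso : Pred Carrier 0ℓ → Pred Carrier 0ℓ → Set
  GraphIso V W = Σ (Carrier → Carrier) λ f →
    Bijective _≡_ _≡_ f × (∀ a b → Adj V a b ⇔ Adj W (f a) (f b))

  NonSquare : Carrier → Set
  NonSquare l = l ≢ 0# × ¬ (∃[ b ] (b * b ≡ l))

{-# OPTIONS --safe #-}
-- Every F_q-hyperplane U of F = F_{q^n} is the kernel of y ↦ Tr(β y) for some β ≠ 0, i.e. U = β⁻¹ U_{q,n}: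
-- since Tr is a polynomial of degree q^{n-1}, counting gives |F_q| = q and a nonzero β with Tr(β bᵢ) = 0
-- on a basis b of U, and x₀ ∉ U completes b to an F_q-basis of F. If β⁻¹ = a² then x ↦ x / a is an
-- isomorphism G_U ≅ G_{U_{q,n}}. For even q every element is a square. For odd q Euler's criterion makes
-- β⁻¹ a square times 1 or a fixed nonsquare λ; when n is also odd, some c ∈ F_q* is a nonsquare of F,
-- and since c U_{q,n} = U_{q,n} the factor c can be absorbed.
module Submission where

open import Defs
open import Level using (0ℓ)
open import Data.Nat as ℕ using (ℕ; zero; suc; _≤_; _<_; z≤n; s≤s; _!)
import Data.Nat.Properties as ℕ
open import Data.Nat.Properties using (_!*_!≢0)
open import Data.Nat.Divisibility using (_∣_; divides; ∣1⇒≡1; ∣⇒≤; m∣m*n; m%n≡0⇒n∣m; ∣m⇒∣m*n; ∣n⇒∣m*n)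
open import Data.Nat.DivMod using (_%_; _/_; m/n*n≡m; m≡m%n+[m/n]*n; m%n<n)
open import Data.Nat.Primality using (Prime; euclidsLemma; prime⇒nonZero; prime⇒nonTrivial; prime[2]; prime⇒irreducible)
open import Data.Nat.Combinatorics using (_C_; k![n∸k]!∣n!; nCn≡1)
open import Data.Nat.Combinatorics.Specification using (nCk≡n!/k![n-k]!)
open import Data.Nat.Tactic.RingSolver using (solve-∀)
open import Data.Integer as ℤ using (ℤ; -[1+_])
import Data.Integer.Properties as ℤ
open import Data.Sign as Sign using (Sign)
open import Data.Fin as Fin using (Fin; toℕ; fromℕ; inject₁)
import Data.Fin.Properties as Fin
open import Data.Vec as Vec using (Vec; []; _∷_; lookup)
import Data.Vec.Properties as Vec
open import Data.Vec.Functional using (tail; init)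
open import Data.List using (List; []; _∷_; length; map; filter; foldr; tabulate; cartesianProductWith)
open import Data.List.Properties using (length-map; length-++; filter-some; length-tabulate)
open import Data.List.Membership.Propositional using (_∈_; find)
open import Data.List.Membership.Propositional.Properties
  using (∈-map⁻; ∈-filter⁺; ∈-filter⁻; ∈-tabulate⁺; ∈-cartesianProductWith⁻)
open import Data.List.Relation.Binary.Subset.Propositional using (_⊆_)
open import Data.List.Relation.Unary.Any as Any using (here; there; any?)
open import Data.List.Relation.Unary.All as All using (All; []; _∷_)
open import Data.List.Relation.Unary.All.Properties using (All¬⇒¬Any; ¬Any⇒All¬)
open import Data.List.Relation.Unary.AllPairs using ([]; _∷_)
open import Data.List.Relation.Unary.Unique.Propositional using (Unique)
import Data.List.Relation.Unary.Unique.Propositional.Properties as Unique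
open import Data.Maybe using (Maybe; just; nothing)
open import Data.Product using (Σ; ∃; ∃-syntax; _×_; _,_; proj₁; proj₂)
open import Data.Sum using (_⊎_; inj₁; inj₂)
open import Relation.Nullary using (¬_; Dec; yes; no; ¬?; contradiction)
open import Relation.Nullary.Decidable using (decidable-stable)
open import Relation.Unary using (Pred)
open import Relation.Binary.Definitions using (DecidableEquality)
open import Relation.Binary.PropositionalEquality
open import Function.Bundles using (_⇔_; mk⇔; Equivalence)
open import Algebra.Bundles using (CommutativeRing)
open import Algebra.Structures using (IsCommutativeRing)
open import Algebra.Solver.Ring.AlmostCommutativeRing using (fromCommutativeRing; _-Raw-AlmostCommutative⟶_)
import Algebra.Properties.Semiring.Exp
import Algebra.Properties.Semiring.Sum
import Algebra.Properties.CommutativeSemiring.Binomial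

prime∤m! : ∀ {p} → Prime p → ∀ m → m < p → ¬ p ∣ m !
prime∤m! pr zero _ p∣1 = ℕ.nonTrivial⇒≢1 {{prime⇒nonTrivial pr}} (∣1⇒≡1 p∣1)
prime∤m! pr (suc m) m<p p∣m! with euclidsLemma (suc m) (m !) pr p∣m!
... | inj₁ p∣1+m = ℕ.<⇒≱ m<p (∣⇒≤ p∣1+m)
... | inj₂ p∣m!′ = prime∤m! pr m (ℕ.<-trans (ℕ.n<1+n m) m<p) p∣m!′

n∣n! : ∀ n → .{{ℕ.NonZero n}} → n ∣ n !
n∣n! (suc n) = m∣m*n (n !)

prime∣pCk : ∀ {p k} → Prime p → 0 < k → k < p → p ∣ p C k
prime∣pCk {p} {k} pr 0<k k<p with euclidsLemma (p C k) (k ! ℕ.* (p ℕ.∸ k) !) pr p∣pCk*d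
  where
  instance
    _ = prime⇒nonZero pr
    _ = k !* (p ℕ.∸ k) !≢0
  pCk*d≡p! : (p C k) ℕ.* (k ! ℕ.* (p ℕ.∸ k) !) ≡ p !
  pCk*d≡p! = trans (cong (ℕ._* (k ! ℕ.* (p ℕ.∸ k) !)) (nCk≡n!/k![n-k]! (ℕ.<⇒≤ k<p)))
                   (m/n*n≡m (k![n∸k]!∣n! (ℕ.<⇒≤ k<p)))
  p∣pCk*d : p ∣ (p C k) ℕ.* (k ! ℕ.* (p ℕ.∸ k) !)
  p∣pCk*d = subst (p ∣_) (sym pCk*d≡p!) (n∣n! p)
... | inj₁ p∣pCk = p∣pCk
... | inj₂ p∣d with euclidsLemma (k !) ((p ℕ.∸ k) !) pr p∣d
...   | inj₁ p∣k! = contradiction p∣k! (prime∤m! pr k k<p)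
...   | inj₂ p∣[p-k]! = contradiction p∣[p-k]! (prime∤m! pr _ (ℕ.∸-monoʳ-< 0<k (ℕ.<⇒≤ k<p)))

prime∣m^j⇒prime∣m : ∀ {p m} → Prime p → ∀ j → p ∣ m ℕ.^ j → p ∣ m
prime∣m^j⇒prime∣m pr zero p∣1 = contradiction (∣1⇒≡1 p∣1) (ℕ.nonTrivial⇒≢1 {{prime⇒nonTrivial pr}})
prime∣m^j⇒prime∣m {m = m} pr (suc j) p∣m^j with euclidsLemma m (m ℕ.^ j) pr p∣m^j
... | inj₁ p∣m = p∣m
... | inj₂ p∣m^j′ = prime∣m^j⇒prime∣m pr j p∣m^j′

odd⇒≡1+2* : ∀ {x} → ¬ 2 ∣ x → x ≡ suc (2 ℕ.* (x / 2))
odd⇒≡1+2* {x} 2∤x with x % 2 | m≡m%n+[m/n]*n x 2 | m%n<n x 2 | m%n≡0⇒n∣m x 2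
... | 0 | _ | _ | %2≡0⇒2∣x = contradiction (%2≡0⇒2∣x refl) 2∤x
... | 1 | x≡ | _ | _ = trans x≡ (cong suc (ℕ.*-comm (x / 2) 2))
... | suc (suc _) | _ | s≤s (s≤s ()) | _

geometric : ℕ → ℕ → ℕ
geometric q zero = 0
geometric q (suc i) = suc (q ℕ.* geometric q i)

[1+2g]^i≡1+2g*geometric : ∀ g i → suc (2 ℕ.* g) ℕ.^ i ≡ suc (2 ℕ.* (g ℕ.* geometric (suc (2 ℕ.* g)) i))
[1+2g]^i≡1+2g*geometric g zero = cong (λ z → suc (2 ℕ.* z)) (sym (ℕ.*-zeroʳ g))
[1+2g]^i≡1+2g*geometric g (suc i) = trans (cong (suc (2 ℕ.* g) ℕ.*_) ([1+2g]^i≡1+2g*geometric g i)) (step g (geometric (suc (2 ℕ.* g)) i))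
  where
  step : ∀ g G → suc (2 ℕ.* g) ℕ.* suc (2 ℕ.* (g ℕ.* G)) ≡ suc (2 ℕ.* (g ℕ.* suc (suc (2 ℕ.* g) ℕ.* G)))
  step = solve-∀

length-filter+filter¬ : ∀ {A : Set} {P : A → Set} (P? : ∀ x → Dec (P x)) xs →
  length xs ≡ length (filter P? xs) ℕ.+ length (filter (λ x → ¬? (P? x)) xs)
length-filter+filter¬ P? [] = refl
length-filter+filter¬ P? (x ∷ xs) with P? x
... | yes _ = cong suc (length-filter+filter¬ P? xs)
... | no _ = trans (cong suc (length-filter+filter¬ P? xs)) (sym (ℕ.+-suc _ _))

Unique-map⁺-on : ∀ {A B : Set} {f : A → B} {xs} → Unique xs → (∀ {x y} → x ∈ xs → y ∈ xs → f x ≡ f y → x ≡ y) →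
                 Unique (map f xs)
Unique-map⁺-on {xs = []} [] _ = []
Unique-map⁺-on {f = f} {xs = x ∷ xs} (x∉xs ∷ u) inj =
  All.tabulate (λ fy∈ fx≡fy → let (y , y∈ , fz≡fy) = ∈-map⁻ f fy∈ in
                 All¬⇒¬Any x∉xs (subst (_∈ xs) (sym (inj (here refl) (there y∈) (trans fx≡fy fz≡fy))) y∈))
  ∷ Unique-map⁺-on u (λ x∈ y∈ → inj (there x∈) (there y∈))

module _ {A : Set} where

  vectors : List A → (l : ℕ) → List (Vec A l)
  vectors S zero = [] ∷ []
  vectors S (suc l) = cartesianProductWith _∷_ S (vectors S l)

  length-vectors : ∀ S l → length (vectors S l) ≡ length S ℕ.^ l
  length-vectors S zero = refl
  length-vectors S (suc l) = trans (length-cartesianProductWith S (vectors S l)) (cong (length S ℕ.*_) (length-vectors S l))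
    where
    length-cartesianProductWith : ∀ {l} (xs : List A) (ys : List (Vec A l)) →
                                  length (cartesianProductWith _∷_ xs ys) ≡ length xs ℕ.* length ys
    length-cartesianProductWith [] ys = refl
    length-cartesianProductWith (x ∷ xs) ys =
      trans (length-++ (map (x ∷_) ys)) (cong₂ ℕ._+_ (length-map (x ∷_) ys) (length-cartesianProductWith xs ys))

  Unique-vectors : ∀ {S} → Unique S → ∀ l → Unique (vectors S l)
  Unique-vectors uS zero = [] ∷ []
  Unique-vectors uS (suc l) = Unique.cartesianProductWith⁺ _∷_ Vec.∷-injective uS (Unique-vectors uS l)

  ∈-vectors⁻ : ∀ {S l v} → v ∈ vectors S l → ∀ i → lookup v i ∈ S
  ∈-vectors⁻ {S} {suc l} v∈ i with ∈-cartesianProductWith⁻ _∷_ S (vectors S l) v∈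
  ∈-vectors⁻ v∈ Fin.zero | _ , _ , s∈S , _ , refl = s∈S
  ∈-vectors⁻ v∈ (Fin.suc i) | _ , _ , _ , w∈ , refl = ∈-vectors⁻ w∈ i

module UniqueList {A : Set} (_≟_ : DecidableEquality A) where

  open import Data.List.Membership.DecPropositional _≟_ using (_∈?_)
  open import Algebra.Definitions {A = A} _≡_ using (Associative; Commutative)

  remove : A → List A → List A
  remove x [] = []
  remove x (y ∷ ys) with x ≟ y
  ... | yes _ = ys
  ... | no _  = y ∷ remove x ys

  length-remove : ∀ {x ys} → x ∈ ys → suc (length (remove x ys)) ≡ length ys
  length-remove {x} {y ∷ ys} x∈ with x ≟ y
  ... | yes _ = refl
  length-remove {x} {y ∷ ys} (here x≡y) | no x≢y = contradiction x≡y x≢y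
  length-remove {x} {y ∷ ys} (there x∈) | no _ = cong suc (length-remove x∈)

  ∈-remove⁺ : ∀ {x y ys} → y ∈ ys → y ≢ x → y ∈ remove x ys
  ∈-remove⁺ {x} {y} {z ∷ ys} y∈ y≢x with x ≟ z
  ∈-remove⁺ (here refl) y≢x | yes refl = contradiction refl y≢x
  ∈-remove⁺ (there y∈) y≢x | yes _ = y∈
  ∈-remove⁺ (here y≡z) y≢x | no _ = here y≡z
  ∈-remove⁺ (there y∈) y≢x | no _ = there (∈-remove⁺ y∈ y≢x)

  ⊆-remove : ∀ {x xs ys} → Unique (x ∷ xs) → x ∷ xs ⊆ ys → xs ⊆ remove x ys
  ⊆-remove (x∉xs ∷ _) sub z∈ = ∈-remove⁺ (sub (there z∈)) (λ { refl → All¬⇒¬Any x∉xs z∈ })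

  Unique-⊆⇒length≤ : ∀ {xs ys} → Unique xs → xs ⊆ ys → length xs ≤ length ys
  Unique-⊆⇒length≤ {[]} _ _ = z≤n
  Unique-⊆⇒length≤ {x ∷ xs} u@(_ ∷ uxs) sub = subst (suc (length xs) ≤_) (length-remove (sub (here refl)))
    (s≤s (Unique-⊆⇒length≤ uxs (⊆-remove u sub)))

  Unique-⊆-length≥⇒⊇ : ∀ {xs ys} → Unique xs → xs ⊆ ys → length ys ≤ length xs → ys ⊆ xs
  Unique-⊆-length≥⇒⊇ {xs} {ys} u sub len {y} y∈ys with y ∈? xs
  ... | yes y∈xs = y∈xs
  ... | no y∉xs = contradiction len (ℕ.<⇒≱ (Unique-⊆⇒length≤ (All.tabulate y≢ ∷ u) y∷xs⊆ys))
    where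
    y≢ : ∀ {z} → z ∈ xs → y ≢ z
    y≢ z∈ refl = y∉xs z∈
    y∷xs⊆ys : y ∷ xs ⊆ ys
    y∷xs⊆ys (here refl) = y∈ys
    y∷xs⊆ys (there z∈) = sub z∈

  length-filter-≢ : ∀ {x xs} → Unique xs → x ∈ xs → length xs ≡ suc (length (filter (λ y → ¬? (y ≟ x)) xs))
  length-filter-≢ {x} {xs} u x∈ = trans (length-filter+filter¬ (_≟ x) xs) (cong (ℕ._+ length (filter (λ y → ¬? (y ≟ x)) xs)) one)
    where
    one : length (filter (_≟ x) xs) ≡ 1
    one = ℕ.≤-antisym
      (Unique-⊆⇒length≤ {ys = x ∷ []} (Unique.filter⁺ (_≟ x) u) (λ y∈ → here (proj₂ (∈-filter⁻ (_≟ x) {xs = xs} y∈))))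
      (filter-some (_≟ x) (Any.map sym x∈))

  module _ {_∙_ : A → A → A} {ε : A} (assoc : Associative _∙_) (comm : Commutative _∙_) where

    foldr-remove : ∀ {x ys} → x ∈ ys → foldr _∙_ ε ys ≡ x ∙ foldr _∙_ ε (remove x ys)
    foldr-remove {x} {y ∷ ys} x∈ with x ≟ y
    ... | yes refl = refl
    foldr-remove {x} {y ∷ ys} (here x≡y) | no x≢y = contradiction x≡y x≢y
    foldr-remove {x} {y ∷ ys} (there x∈) | no _ = begin
      y ∙ foldr _∙_ ε ys                       ≡⟨ cong (y ∙_) (foldr-remove x∈) ⟩
      y ∙ (x ∙ foldr _∙_ ε (remove x ys))      ≡⟨ sym (assoc y x _) ⟩
      (y ∙ x) ∙ foldr _∙_ ε (remove x ys)      ≡⟨ cong (_∙ foldr _∙_ ε (remove x ys)) (comm y x) ⟩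
      (x ∙ y) ∙ foldr _∙_ ε (remove x ys)      ≡⟨ assoc x y _ ⟩
      x ∙ (y ∙ foldr _∙_ ε (remove x ys))      ∎
      where open ≡-Reasoning

    foldr-⊆ : ∀ {xs ys} → Unique xs → xs ⊆ ys → length ys ≤ length xs → foldr _∙_ ε xs ≡ foldr _∙_ ε ys
    foldr-⊆ {[]} {[]} _ _ _ = refl
    foldr-⊆ {x ∷ xs} {ys} u@(_ ∷ uxs) sub len = trans
      (cong (x ∙_) (foldr-⊆ uxs (⊆-remove u sub) (ℕ.≤-pred (subst (ℕ._≤ suc (length xs)) (sym (length-remove x∈ys)) len))))
      (sym (foldr-remove x∈ys))
      where x∈ys = sub (here refl)

    foldr-map-permutation : ∀ {f xs} → (∀ {x y} → f x ≡ f y → x ≡ y) → Unique xs → (∀ {x} → x ∈ xs → f x ∈ xs) →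
                            foldr _∙_ ε (map f xs) ≡ foldr _∙_ ε xs
    foldr-map-permutation {f} {xs} inj u closed = foldr-⊆ (Unique.map⁺ inj u)
      (λ y∈ → let (x , x∈ , y≡fx) = ∈-map⁻ f y∈ in subst (_∈ xs) (sym y≡fx) (closed x∈))
      (ℕ.≤-reflexive (sym (length-map f xs)))

  pigeonhole : (g : A → A) (B : ℕ) (S L : List A) → Unique L → (∀ {x} → x ∈ L → g x ∈ S) → length S ℕ.* B < length L →
               ∃[ s ] ∃[ M ] (Unique M × M ⊆ L × All (λ x → g x ≡ s) M × B < length M)
  pigeonhole g B [] [] _ _ ()
  pigeonhole g B [] (x ∷ L) _ maps _ with () ← maps (here refl)
  pigeonhole g B (s ∷ S) L u maps big with B ℕ.<? length (filter (λ x → g x ≟ s) L)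
  ... | yes fibre-big = s , filter (λ x → g x ≟ s) L , Unique.filter⁺ _ u , (λ x∈ → proj₁ (∈-filter⁻ (λ x → g x ≟ s) {xs = L} x∈)) ,
                        All.tabulate (λ x∈ → proj₂ (∈-filter⁻ (λ x → g x ≟ s) {xs = L} x∈)) , fibre-big
  ... | no fibre-small
    with pigeonhole g B S L′ (Unique.filter⁺ _ u) maps′ big′
    where
    L′ = filter (λ x → ¬? (g x ≟ s)) L
    maps′ : ∀ {x} → x ∈ L′ → g x ∈ S
    maps′ x∈ with ∈-filter⁻ (λ x → ¬? (g x ≟ s)) x∈
    ... | x∈L , gx≢s with maps x∈L
    ...   | here gx≡s = contradiction gx≡s gx≢s
    ...   | there gx∈S = gx∈S
    big′ : length S ℕ.* B < length L′
    big′ = ℕ.+-cancelˡ-< B _ _ (ℕ.<-≤-trans big (ℕ.≤-trans (ℕ.≤-reflexive (length-filter+filter¬ (λ x → g x ≟ s) L))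
             (ℕ.+-monoˡ-≤ _ (ℕ.≮⇒≥ fibre-small))))
  ... | s′ , M , uM , M⊆L′ , fibre , M-big =
    s′ , M , uM , (λ x∈ → proj₁ (∈-filter⁻ (λ x → ¬? (g x ≟ s)) {xs = L} (M⊆L′ x∈))) , fibre , M-big

module IntegerCoefficientRingSolver {A : Set} {add mul : A → A → A} {neg : A → A} {zero′ one : A}
  (isCommutativeRing : IsCommutativeRing _≡_ add mul neg zero′ one) where

  private
    ring : CommutativeRing 0ℓ 0ℓ
    ring = record { isCommutativeRing = isCommutativeRing }

    open CommutativeRing ring using (_+_; _*_; -_; 0#; 1#; +-identityˡ; +-identityʳ; +-assoc; +-comm; -‿inverseʳ; semiring; +-abelianGroup)
      renaming (ring to ring′)
    open import Algebra.Properties.Semiring.Mult semiring using (×-homo-+; ×1-homo-*) renaming (_×_ to _×ₙ_)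
    open import Algebra.Properties.Ring ring′ using (-‿distribˡ-*; -‿distribʳ-*; -0#≈0#)
    open import Algebra.Properties.AbelianGroup +-abelianGroup using (⁻¹-involutive; ⁻¹-∙-comm)

    x≡x+y-y : ∀ x y → x ≡ x + y + - y
    x≡x+y-y x y = sym (trans (+-assoc x y (- y)) (trans (cong (x +_) (-‿inverseʳ y)) (+-identityʳ x)))

    -x≡y-[x+y] : ∀ x y → - x ≡ y + - (x + y)
    -x≡y-[x+y] x y = sym (begin
      y + - (x + y)       ≡⟨ cong (y +_) (trans (sym (⁻¹-∙-comm x y)) (+-comm (- x) (- y))) ⟩
      y + (- y + - x)     ≡⟨ sym (+-assoc y (- y) (- x)) ⟩
      y + - y + - x       ≡⟨ cong (_+ - x) (-‿inverseʳ y) ⟩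
      0# + - x            ≡⟨ +-identityˡ (- x) ⟩
      - x                 ∎)
      where open ≡-Reasoning

    ι : ℤ → A
    ι (ℤ.+ n) = n ×ₙ 1#
    ι -[1+ n ] = - (suc n ×ₙ 1#)

    signed : Sign → A → A
    signed Sign.+ x = x
    signed Sign.- x = - x

    ι-◃ : ∀ s n → ι (s ℤ.◃ n) ≡ signed s (n ×ₙ 1#)
    ι-◃ Sign.+ zero = refl
    ι-◃ Sign.- zero = sym -0#≈0#
    ι-◃ Sign.+ (suc n) = refl
    ι-◃ Sign.- (suc n) = refl

    signed-* : ∀ s t x y → signed (s Sign.* t) (x * y) ≡ signed s x * signed t y
    signed-* Sign.+ Sign.+ x y = refl
    signed-* Sign.+ Sign.- x y = -‿distribʳ-* x y
    signed-* Sign.- Sign.+ x y = -‿distribˡ-* x y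
    signed-* Sign.- Sign.- x y = trans (sym (⁻¹-involutive (x * y)))
      (trans (cong -_ (-‿distribˡ-* x y)) (-‿distribʳ-* (- x) y))

    ι-* : ∀ i j → ι (i ℤ.* j) ≡ ι i * ι j
    ι-* i j = begin
      ι (i ℤ.* j)                                          ≡⟨ ι-◃ (ℤ.sign i Sign.* ℤ.sign j) (ℤ.∣ i ∣ ℕ.* ℤ.∣ j ∣) ⟩
      signed (ℤ.sign i Sign.* ℤ.sign j) ((ℤ.∣ i ∣ ℕ.* ℤ.∣ j ∣) ×ₙ 1#)
        ≡⟨ cong (signed (ℤ.sign i Sign.* ℤ.sign j)) (×1-homo-* ℤ.∣ i ∣ ℤ.∣ j ∣) ⟩
      signed (ℤ.sign i Sign.* ℤ.sign j) ((ℤ.∣ i ∣ ×ₙ 1#) * (ℤ.∣ j ∣ ×ₙ 1#))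
        ≡⟨ signed-* (ℤ.sign i) (ℤ.sign j) _ _ ⟩
      signed (ℤ.sign i) (ℤ.∣ i ∣ ×ₙ 1#) * signed (ℤ.sign j) (ℤ.∣ j ∣ ×ₙ 1#)
        ≡⟨ sym (cong₂ _*_ (ι-sign-abs i) (ι-sign-abs j)) ⟩
      ι i * ι j                                            ∎
      where
      open ≡-Reasoning
      ι-sign-abs : ∀ i → ι i ≡ signed (ℤ.sign i) (ℤ.∣ i ∣ ×ₙ 1#)
      ι-sign-abs i = trans (cong ι (sym (ℤ.◃-inverse i))) (ι-◃ (ℤ.sign i) ℤ.∣ i ∣)

    ι-neg : ∀ i → ι (ℤ.- i) ≡ - ι i
    ι-neg (ℤ.+ zero) = sym -0#≈0#
    ι-neg (ℤ.+ suc n) = refl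
    ι-neg -[1+ n ] = sym (⁻¹-involutive _)

    ι-⊖ : ∀ m n → ι (m ℤ.⊖ n) ≡ m ×ₙ 1# + - (n ×ₙ 1#)
    ι-⊖ m n with ℕ.≤-total n m
    ... | inj₁ n≤m = begin
      ι (m ℤ.⊖ n)                                    ≡⟨ cong ι (ℤ.⊖-≥ n≤m) ⟩
      (m ℕ.∸ n) ×ₙ 1#                                 ≡⟨ x≡x+y-y _ _ ⟩
      ((m ℕ.∸ n) ×ₙ 1# + n ×ₙ 1#) + - (n ×ₙ 1#)         ≡⟨ cong (λ z → z + - (n ×ₙ 1#)) (sym (×-homo-+ 1# (m ℕ.∸ n) n)) ⟩
      ((m ℕ.∸ n) ℕ.+ n) ×ₙ 1# + - (n ×ₙ 1#)            ≡⟨ cong (λ k → k ×ₙ 1# + - (n ×ₙ 1#)) (ℕ.m∸n+n≡m n≤m) ⟩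
      m ×ₙ 1# + - (n ×ₙ 1#)                            ∎
      where open ≡-Reasoning
    ... | inj₂ m≤n = begin
      ι (m ℤ.⊖ n)                                    ≡⟨ cong ι (ℤ.⊖-≤ m≤n) ⟩
      ι (ℤ.- (ℤ.+ (n ℕ.∸ m)))                        ≡⟨ ι-neg (ℤ.+ (n ℕ.∸ m)) ⟩
      - ((n ℕ.∸ m) ×ₙ 1#)                             ≡⟨ -x≡y-[x+y] _ _ ⟩
      m ×ₙ 1# + - ((n ℕ.∸ m) ×ₙ 1# + m ×ₙ 1#)           ≡⟨ cong (λ z → m ×ₙ 1# + - z) (sym (×-homo-+ 1# (n ℕ.∸ m) m)) ⟩
      m ×ₙ 1# + - (((n ℕ.∸ m) ℕ.+ m) ×ₙ 1#)            ≡⟨ cong (λ k → m ×ₙ 1# + - (k ×ₙ 1#)) (ℕ.m∸n+n≡m m≤n) ⟩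
      m ×ₙ 1# + - (n ×ₙ 1#)                            ∎
      where open ≡-Reasoning

    ι-+ : ∀ i j → ι (i ℤ.+ j) ≡ ι i + ι j
    ι-+ (ℤ.+ m) (ℤ.+ n) = ×-homo-+ 1# m n
    ι-+ (ℤ.+ m) -[1+ n ] = ι-⊖ m (suc n)
    ι-+ -[1+ m ] (ℤ.+ n) = trans (ι-⊖ n (suc m)) (+-comm _ _)
    ι-+ -[1+ m ] -[1+ n ] = begin
      - (suc (suc (m ℕ.+ n)) ×ₙ 1#)                   ≡⟨ cong (λ k → - (suc k ×ₙ 1#)) (sym (ℕ.+-suc m n)) ⟩
      - ((suc m ℕ.+ suc n) ×ₙ 1#)                     ≡⟨ cong -_ (×-homo-+ 1# (suc m) (suc n)) ⟩
      - (suc m ×ₙ 1# + suc n ×ₙ 1#)                    ≡⟨ sym (⁻¹-∙-comm _ _) ⟩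
      - (suc m ×ₙ 1#) + - (suc n ×ₙ 1#)                ∎
      where open ≡-Reasoning

    homomorphism : ℤ.+-*-rawRing -Raw-AlmostCommutative⟶ fromCommutativeRing ring
    homomorphism = record
      { ⟦_⟧ = ι ; +-homo = ι-+ ; *-homo = ι-* ; -‿homo = ι-neg ; 0-homo = refl ; 1-homo = +-identityʳ 1# }

    ι-≟ : ∀ i j → Maybe (ι i ≡ ι j)
    ι-≟ i j with i ℤ.≟ j
    ... | yes i≡j = just (cong ι i≡j)
    ... | no _ = nothing

  open import Algebra.Solver.Ring ℤ.+-*-rawRing (fromCommutativeRing ring) homomorphism ι-≟ public
    using (solve; _:=_; _:+_; _:*_; :-_; _:-_)

module FieldBasics (F : FiniteField) where

  open FiniteField F public
  open IsCommutativeRing isCommutativeRing public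
    using (+-assoc; +-comm; *-assoc; *-comm; +-identityˡ; +-identityʳ; *-identityˡ; *-identityʳ;
           distribˡ; distribʳ; -‿inverseʳ; zeroˡ; zeroʳ)

  commutativeRing : CommutativeRing 0ℓ 0ℓ
  commutativeRing = record { isCommutativeRing = isCommutativeRing }

  private
    decide-∈ : ∀ {xs : List Carrier} {x y} → Unique xs → x ∈ xs → y ∈ xs → Dec (x ≡ y)
    decide-∈ _ (here x≡z) (here y≡z) = yes (trans x≡z (sym y≡z))
    decide-∈ (z∉ ∷ _) (here x≡z) (there y∈) = no λ x≡y → All¬⇒¬Any z∉ (subst (_∈ _) (trans (sym x≡y) x≡z) y∈)
    decide-∈ (z∉ ∷ _) (there x∈) (here y≡z) = no λ x≡y → All¬⇒¬Any z∉ (subst (_∈ _) (trans x≡y y≡z) x∈)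
    decide-∈ (_ ∷ u) (there x∈) (there y∈) = decide-∈ u x∈ y∈

  infix 4 _≟_
  _≟_ : DecidableEquality Carrier
  x ≟ y = decide-∈ elements-unique (elements-complete x) (elements-complete y)

  open IntegerCoefficientRingSolver isCommutativeRing public using (solve; _:=_; _:+_; _:*_; :-_; _:-_)
  open import Algebra.Properties.Ring (CommutativeRing.ring commutativeRing) public using (-1*x≈-x)

  infixl 6 _-_
  _-_ : Carrier → Carrier → Carrier
  x - y = x + - y

  x-y≡0⇒x≡y : ∀ {x y} → x - y ≡ 0# → x ≡ y
  x-y≡0⇒x≡y {x} {y} x-y≡0 = begin
    x             ≡⟨ solve 2 (λ x y → x := x :- y :+ y) refl x y ⟩
    x - y + y     ≡⟨ cong (_+ y) x-y≡0 ⟩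
    0# + y        ≡⟨ +-identityˡ y ⟩
    y             ∎
    where open ≡-Reasoning

  1≢0 : 1# ≢ 0#
  1≢0 1≡0 = 0≢1 (sym 1≡0)

  inv : (x : Carrier) → x ≢ 0# → Carrier
  inv x x≢0 = proj₁ (inverse x x≢0)

  *-inverseʳ : ∀ x (x≢0 : x ≢ 0#) → x * inv x x≢0 ≡ 1#
  *-inverseʳ x x≢0 = proj₂ (inverse x x≢0)

  *-inverseˡ : ∀ x (x≢0 : x ≢ 0#) → inv x x≢0 * x ≡ 1#
  *-inverseˡ x x≢0 = trans (*-comm _ x) (*-inverseʳ x x≢0)

  z/w*w≡z : ∀ {z w} (w≢0 : w ≢ 0#) → z * inv w w≢0 * w ≡ z
  z/w*w≡z {z} {w} w≢0 = trans (*-assoc z _ w) (trans (cong (z *_) (*-inverseˡ w w≢0)) (*-identityʳ z))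

  *-cancelˡ : ∀ {a x y} → a ≢ 0# → a * x ≡ a * y → x ≡ y
  *-cancelˡ {a} {x} {y} a≢0 ax≡ay = begin
    x                    ≡⟨ sym (trans (cong (_* x) (*-inverseˡ a a≢0)) (*-identityˡ x)) ⟩
    inv a a≢0 * a * x    ≡⟨ *-assoc _ a x ⟩
    inv a a≢0 * (a * x)  ≡⟨ cong (inv a a≢0 *_) ax≡ay ⟩
    inv a a≢0 * (a * y)  ≡⟨ sym (*-assoc _ a y) ⟩
    inv a a≢0 * a * y    ≡⟨ trans (cong (_* y) (*-inverseˡ a a≢0)) (*-identityˡ y) ⟩
    y                    ∎
    where open ≡-Reasoning

  *-≢0 : ∀ {x y} → x ≢ 0# → y ≢ 0# → x * y ≢ 0#
  *-≢0 {x} x≢0 y≢0 xy≡0 = y≢0 (*-cancelˡ x≢0 (trans xy≡0 (sym (zeroʳ x))))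

  *≢0⇒≢0ˡ : ∀ {x y} → x * y ≢ 0# → x ≢ 0#
  *≢0⇒≢0ˡ {y = y} xy≢0 x≡0 = xy≢0 (trans (cong (_* y) x≡0) (zeroˡ y))

  inv-≢0 : ∀ x (x≢0 : x ≢ 0#) → inv x x≢0 ≢ 0#
  inv-≢0 x x≢0 x⁻¹≡0 = 1≢0 (trans (sym (*-inverseʳ x x≢0)) (trans (cong (x *_) x⁻¹≡0) (zeroʳ x)))

  x*y≡0⇒x≡0∨y≡0 : ∀ {x y} → x * y ≡ 0# → x ≡ 0# ⊎ y ≡ 0#
  x*y≡0⇒x≡0∨y≡0 {x} {y} xy≡0 with x ≟ 0# | y ≟ 0#
  ... | yes x≡0 | _ = inj₁ x≡0
  ... | no _ | yes y≡0 = inj₂ y≡0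
  ... | no x≢0 | no y≢0 = contradiction xy≡0 (*-≢0 x≢0 y≢0)

  x*x≡0⇒x≡0 : ∀ {x} → x * x ≡ 0# → x ≡ 0#
  x*x≡0⇒x≡0 x²≡0 with x*y≡0⇒x≡0∨y≡0 x²≡0
  ... | inj₁ x≡0 = x≡0
  ... | inj₂ x≡0 = x≡0

  ^-distribˡ-+-* : ∀ x a b → x ^ (a ℕ.+ b) ≡ x ^ a * x ^ b
  ^-distribˡ-+-* x zero b = sym (*-identityˡ _)
  ^-distribˡ-+-* x (suc a) b = trans (cong (x *_) (^-distribˡ-+-* x a b)) (sym (*-assoc _ _ _))

  ^-distribʳ-* : ∀ x y a → (x * y) ^ a ≡ x ^ a * y ^ a
  ^-distribʳ-* x y zero = sym (*-identityˡ 1#)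
  ^-distribʳ-* x y (suc a) = trans (cong (x * y *_) (^-distribʳ-* x y a))
    (solve 4 (λ x y X Y → x :* y :* (X :* Y) := x :* X :* (y :* Y)) refl x y (x ^ a) (y ^ a))

  1^n≡1 : ∀ a → 1# ^ a ≡ 1#
  1^n≡1 zero = refl
  1^n≡1 (suc a) = trans (*-identityˡ _) (1^n≡1 a)

  ^-*-assoc : ∀ x a b → (x ^ a) ^ b ≡ x ^ (a ℕ.* b)
  ^-*-assoc x zero b = 1^n≡1 b
  ^-*-assoc x (suc a) b = begin
    (x * x ^ a) ^ b         ≡⟨ ^-distribʳ-* x (x ^ a) b ⟩
    x ^ b * (x ^ a) ^ b     ≡⟨ cong (x ^ b *_) (^-*-assoc x a b) ⟩
    x ^ b * x ^ (a ℕ.* b)   ≡⟨ sym (^-distribˡ-+-* x b (a ℕ.* b)) ⟩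
    x ^ (b ℕ.+ a ℕ.* b)     ∎
    where open ≡-Reasoning

  0^n≡0 : ∀ {a} → 0 < a → 0# ^ a ≡ 0#
  0^n≡0 {suc a} _ = zeroˡ _

  ^-≢0 : ∀ {x} a → x ≢ 0# → x ^ a ≢ 0#
  ^-≢0 zero _ = 1≢0
  ^-≢0 (suc a) x≢0 = *-≢0 x≢0 (^-≢0 a x≢0)

  open import Algebra.Properties.Semiring.Mult (CommutativeRing.semiring commutativeRing) public
    using (×1-homo-*; ×-assoc-*) renaming (_×_ to _×ₙ_)
  open UniqueList _≟_

  nonzeros : List Carrier
  nonzeros = filter (λ x → ¬? (x ≟ 0#)) elements

  Unique-nonzeros : Unique nonzeros
  Unique-nonzeros = Unique.filter⁺ _ elements-unique

  ∈-nonzeros⁺ : ∀ {x} → x ≢ 0# → x ∈ nonzeros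
  ∈-nonzeros⁺ {x} x≢0 = ∈-filter⁺ (λ x → ¬? (x ≟ 0#)) (elements-complete x) x≢0

  ∈-nonzeros⁻ : ∀ {x} → x ∈ nonzeros → x ≢ 0#
  ∈-nonzeros⁻ x∈ = proj₂ (∈-filter⁻ (λ x → ¬? (x ≟ 0#)) {xs = elements} x∈)

  order≡1+|nonzeros| : order ≡ suc (length nonzeros)
  order≡1+|nonzeros| = length-filter-≢ elements-unique (elements-complete 0#)

  product-map-* : ∀ a xs → foldr _*_ 1# (map (a *_) xs) ≡ a ^ length xs * foldr _*_ 1# xs
  product-map-* a [] = sym (*-identityˡ 1#)
  product-map-* a (x ∷ xs) = trans (cong (a * x *_) (product-map-* a xs))
    (solve 4 (λ a x A P → a :* x :* (A :* P) := a :* A :* (x :* P)) refl a x (a ^ length xs) (foldr _*_ 1# xs))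

  -- Multiplication by a nonzero a permutes the nonzero elements, so a ^ |F*| * ∏ F* ≡ ∏ F*.
  a^|F*|≡1 : ∀ {a} → a ≢ 0# → a ^ length nonzeros ≡ 1#
  a^|F*|≡1 {a} a≢0 = *-cancelˡ ∏≢0 (trans (*-comm ∏ _) (trans (sym (product-map-* a nonzeros))
    (trans (foldr-map-permutation *-assoc *-comm (*-cancelˡ a≢0) Unique-nonzeros
             (λ x∈ → ∈-nonzeros⁺ (*-≢0 a≢0 (∈-nonzeros⁻ x∈))))
           (sym (*-identityʳ ∏)))))
    where
    ∏ = foldr _*_ 1# nonzeros
    product-≢0 : ∀ {xs} → All (_≢ 0#) xs → foldr _*_ 1# xs ≢ 0#
    product-≢0 [] = 1≢0
    product-≢0 (x≢0 ∷ xs≢0) = *-≢0 x≢0 (product-≢0 xs≢0)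
    ∏≢0 : ∏ ≢ 0#
    ∏≢0 = product-≢0 (All.tabulate ∈-nonzeros⁻)

  x^order≡x : ∀ x → x ^ order ≡ x
  x^order≡x x rewrite order≡1+|nonzeros| with x ≟ 0#
  ... | yes refl = zeroˡ _
  ... | no x≢0 = trans (cong (x *_) (a^|F*|≡1 x≢0)) (*-identityʳ x)

  sum-map-+ : ∀ a xs → foldr _+_ 0# (map (a +_) xs) ≡ length xs ×ₙ a + foldr _+_ 0# xs
  sum-map-+ a [] = sym (+-identityˡ 0#)
  sum-map-+ a (x ∷ xs) = trans (cong (a + x +_) (sum-map-+ a xs))
    (solve 4 (λ a x M S → a :+ x :+ (M :+ S) := a :+ M :+ (x :+ S)) refl a x (length xs ×ₙ a) (foldr _+_ 0# xs))

  -- Translation by 1# permutes the field, so ∑ F + order · 1# ≡ ∑ F.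
  order×1≡0 : order ×ₙ 1# ≡ 0#
  order×1≡0 = begin
    order ×ₙ 1#                 ≡⟨ solve 2 (λ a s → a := a :+ s :- s) refl (order ×ₙ 1#) ∑F ⟩
    order ×ₙ 1# + ∑F - ∑F       ≡⟨ cong (_- ∑F) (sym (sum-map-+ 1# elements)) ⟩
    foldr _+_ 0# (map (1# +_) elements) - ∑F
      ≡⟨ cong (_- ∑F) (foldr-map-permutation +-assoc +-comm +-cancelˡ elements-unique (λ {x} _ → elements-complete (1# + x))) ⟩
    ∑F - ∑F                     ≡⟨ -‿inverseʳ ∑F ⟩
    0#                          ∎
    where
    open ≡-Reasoning
    ∑F = foldr _+_ 0# elements
    +-cancelˡ : ∀ {x y} → 1# + x ≡ 1# + y → x ≡ y
    +-cancelˡ {x} {y} eq = x-y≡0⇒x≡y (trans (solve 3 (λ o x y → x :- y := o :+ x :- (o :+ y)) refl 1# x y)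
                                             (trans (cong (_- (1# + y)) eq) (-‿inverseʳ (1# + y))))

  order≡p^m⇒p×1≡0 : ∀ {p m} → order ≡ p ℕ.^ m → p ×ₙ 1# ≡ 0#
  order≡p^m⇒p×1≡0 {p} {m} order≡p^m with p ×ₙ 1# ≟ 0#
  ... | yes p×1≡0 = p×1≡0
  ... | no p×1≢0 = contradiction (trans (sym (×1-^ m)) (trans (cong (_×ₙ 1#) (sym order≡p^m)) order×1≡0)) (^-≢0 m p×1≢0)
    where
    ×1-^ : ∀ m → (p ℕ.^ m) ×ₙ 1# ≡ (p ×ₙ 1#) ^ m
    ×1-^ zero = +-identityʳ 1#
    ×1-^ (suc m) = trans (×1-homo-* p (p ℕ.^ m)) (cong (p ×ₙ 1# *_) (×1-^ m))

  private
    module Exp = Algebra.Properties.Semiring.Exp (CommutativeRing.semiring commutativeRing)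
    module Binomial = Algebra.Properties.CommutativeSemiring.Binomial (CommutativeRing.commutativeSemiring commutativeRing)
    open Algebra.Properties.Semiring.Sum (CommutativeRing.semiring commutativeRing) using (sum; sum-init-last; sum-cong-≗; sum-replicate-zero)

    ^ᴱ≡^ : ∀ x n → x Exp.^ n ≡ x ^ n
    ^ᴱ≡^ x zero = refl
    ^ᴱ≡^ x (suc n) = cong (x *_) (^ᴱ≡^ x n)

  multiple-of-char×x≡0 : ∀ {p n} → p ×ₙ 1# ≡ 0# → p ∣ n → ∀ x → n ×ₙ x ≡ 0#
  multiple-of-char×x≡0 {p} p×1≡0 (divides c refl) x = begin
    (c ℕ.* p) ×ₙ x                       ≡⟨ cong ((c ℕ.* p) ×ₙ_) (sym (*-identityˡ x)) ⟩
    (c ℕ.* p) ×ₙ (1# * x)                ≡⟨ sym (×-assoc-* (c ℕ.* p) 1# x) ⟩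
    ((c ℕ.* p) ×ₙ 1#) * x                ≡⟨ cong (_* x) (×1-homo-* c p) ⟩
    (c ×ₙ 1#) * (p ×ₙ 1#) * x            ≡⟨ cong (λ z → (c ×ₙ 1#) * z * x) p×1≡0 ⟩
    (c ×ₙ 1#) * 0# * x                   ≡⟨ trans (cong (_* x) (zeroʳ _)) (zeroˡ x) ⟩
    0#                                   ∎
    where open ≡-Reasoning

  Additive : ℕ → Set
  Additive e = ∀ x y → (x + y) ^ e ≡ x ^ e + y ^ e

  -- Binomial theorem: all middle coefficients p C k are multiples of p.
  frobenius : ∀ {p} → Prime p → p ×ₙ 1# ≡ 0# → Additive p
  frobenius {suc p′} pr p×1≡0 x y = begin
    (x + y) ^ p                                                   ≡⟨ sym (^ᴱ≡^ (x + y) p) ⟩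
    (x + y) Exp.^ p                                               ≡⟨ Binomial.theorem p x y ⟩
    t Fin.zero + sum (tail t)                                     ≡⟨ cong (t Fin.zero +_) (sum-init-last (tail t)) ⟩
    t Fin.zero + (sum (init (tail t)) + t (Fin.suc (fromℕ p′)))   ≡⟨ cong₂ (λ a b → t Fin.zero + (a + b)) middle≡0 last≡x^p ⟩
    t Fin.zero + (0# + x ^ p)                                     ≡⟨ cong₂ _+_ first≡y^p (+-identityˡ (x ^ p)) ⟩
    y ^ p + x ^ p                                                 ≡⟨ +-comm (y ^ p) (x ^ p) ⟩
    x ^ p + y ^ p                                                 ∎
    where
    open ≡-Reasoning
    p = suc p′
    t = Binomial.binomialTerm x y p
    first≡y^p : t Fin.zero ≡ y ^ p
    first≡y^p = trans (+-identityʳ _) (trans (*-identityˡ _) (^ᴱ≡^ y p))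
    last≡x^p : t (Fin.suc (fromℕ p′)) ≡ x ^ p
    last≡x^p = begin
      t (Fin.suc (fromℕ p′))                      ≡⟨ cong (λ k → (p C k) ×ₙ (x Exp.^ k * y Exp.^ (p ℕ.∸ k))) (cong suc (Fin.toℕ-fromℕ p′)) ⟩
      (p C p) ×ₙ (x Exp.^ p * y Exp.^ (p ℕ.∸ p))  ≡⟨ cong₂ (λ c e → c ×ₙ (x Exp.^ p * y Exp.^ e)) (nCn≡1 p) (ℕ.n∸n≡0 p) ⟩
      1 ×ₙ (x Exp.^ p * 1#)                       ≡⟨ trans (+-identityʳ _) (*-identityʳ _) ⟩
      x Exp.^ p                                   ≡⟨ ^ᴱ≡^ x p ⟩
      x ^ p                                       ∎
    middle≡0 : sum (init (tail t)) ≡ 0#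
    middle≡0 = trans (sum-cong-≗ middle-term≡0) (sum-replicate-zero p′)
      where
      middle-term≡0 : ∀ i → t (Fin.suc (inject₁ i)) ≡ 0#
      middle-term≡0 i = multiple-of-char×x≡0 p×1≡0 (prime∣pCk pr (s≤s z≤n) (s≤s k<p′)) _
        where
        k<p′ : Fin.toℕ (inject₁ i) < p′
        k<p′ = subst (_< p′) (sym (Fin.toℕ-inject₁ i)) (Fin.toℕ<n i)

  Additive-* : ∀ {a b} → Additive a → Additive b → Additive (a ℕ.* b)
  Additive-* {a} {b} additive-a additive-b x y = begin
    (x + y) ^ (a ℕ.* b)           ≡⟨ sym (^-*-assoc (x + y) a b) ⟩
    ((x + y) ^ a) ^ b             ≡⟨ cong (_^ b) (additive-a x y) ⟩
    (x ^ a + y ^ a) ^ b           ≡⟨ additive-b _ _ ⟩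
    (x ^ a) ^ b + (y ^ a) ^ b     ≡⟨ cong₂ _+_ (^-*-assoc x a b) (^-*-assoc y a b) ⟩
    x ^ (a ℕ.* b) + y ^ (a ℕ.* b) ∎
    where open ≡-Reasoning

  Additive-^ : ∀ {a} → Additive a → ∀ j → Additive (a ℕ.^ j)
  Additive-^ _ zero x y = trans (*-identityʳ _) (sym (cong₂ _+_ (*-identityʳ x) (*-identityʳ y)))
  Additive-^ {a} additive-a (suc j) = Additive-* {a} {a ℕ.^ j} additive-a (Additive-^ additive-a j)

  Additive-neg : ∀ {e} → 0 < e → Additive e → ∀ x → (- x) ^ e ≡ - (x ^ e)
  Additive-neg {e} 0<e additive x = begin
    (- x) ^ e                          ≡⟨ solve 2 (λ a b → b := :- a :+ (a :+ b)) refl (x ^ e) ((- x) ^ e) ⟩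
    - (x ^ e) + (x ^ e + (- x) ^ e)    ≡⟨ cong (- (x ^ e) +_) (sym (additive x (- x))) ⟩
    - (x ^ e) + (x + - x) ^ e          ≡⟨ cong (λ z → - (x ^ e) + z ^ e) (-‿inverseʳ x) ⟩
    - (x ^ e) + 0# ^ e                 ≡⟨ trans (cong (- (x ^ e) +_) (0^n≡0 0<e)) (+-identityʳ _) ⟩
    - (x ^ e)                          ∎
    where open ≡-Reasoning

module Polynomials (F : FiniteField) where

  open FieldBasics F

  -- Coefficient vectors list the leading coefficient first.
  eval : ∀ {D} → Vec Carrier D → Carrier → Carrier
  eval [] x = 0#
  eval {suc D} (c ∷ cs) x = c * x ^ D + eval cs x

  -- Synthetic division by x - r.
  quotient : ∀ {D} → Carrier → Vec Carrier (suc D) → Vec Carrier D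
  quotient r (a ∷ []) = []
  quotient r (a ∷ a′ ∷ as) = a ∷ quotient r ((a′ + r * a) ∷ as)

  remainder : ∀ {D} → Carrier → Vec Carrier (suc D) → Carrier
  remainder r (a ∷ []) = a
  remainder r (a ∷ a′ ∷ as) = remainder r ((a′ + r * a) ∷ as)

  eval-division : ∀ {D} r (v : Vec Carrier (suc D)) x → eval v x ≡ (x - r) * eval (quotient r v) x + remainder r v
  eval-division r (a ∷ []) x = trans (trans (+-identityʳ _) (*-identityʳ a)) (sym (trans (cong (_+ a) (zeroʳ _)) (+-identityˡ a)))
  eval-division {suc D} r (a ∷ a′ ∷ as) x = begin
    a * (x * X) + (a′ * X + H)                   ≡⟨ solve 6 (λ a x X a′ H r → a :* (x :* X) :+ (a′ :* X :+ H)
                                                         := (x :- r) :* (a :* X) :+ ((a′ :+ r :* a) :* X :+ H)) refl a x X a′ H r ⟩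
    (x - r) * (a * X) + ((a′ + r * a) * X + H)   ≡⟨ cong ((x - r) * (a * X) +_) (eval-division r ((a′ + r * a) ∷ as) x) ⟩
    (x - r) * (a * X) + ((x - r) * Q + R)        ≡⟨ solve 5 (λ x r A Q R → (x :- r) :* A :+ ((x :- r) :* Q :+ R)
                                                         := (x :- r) :* (A :+ Q) :+ R) refl x r (a * X) Q R ⟩
    (x - r) * (a * X + Q) + R                    ∎
    where
    open ≡-Reasoning
    X = x ^ D
    H = eval as x
    Q = eval (quotient r ((a′ + r * a) ∷ as)) x
    R = remainder r ((a′ + r * a) ∷ as)

  remainder≡eval : ∀ {D} r (v : Vec Carrier (suc D)) → remainder r v ≡ eval v r
  remainder≡eval r v = sym (trans (eval-division r v r)
    (trans (cong (λ z → z * eval (quotient r v) r + remainder r v) (-‿inverseʳ r))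
           (trans (cong (_+ remainder r v) (zeroˡ _)) (+-identityˡ _))))

  Poly< : ℕ → (Carrier → Carrier) → Set
  Poly< D f = Σ (Vec Carrier D) λ v → ∀ x → eval v x ≡ f x

  Monic : ℕ → (Carrier → Carrier) → Set
  Monic D f = Σ (Carrier → Carrier) λ g → Poly< D g × (∀ x → f x ≡ x ^ D + g x)

  monic-factor : ∀ {D f} → Monic (suc D) f → ∀ r → Σ (Carrier → Carrier) λ h → Monic D h × (∀ x → f x ≡ (x - r) * h x + f r)
  monic-factor {D} {f} (g , (a′ ∷ as , eval≡g) , f≡) r =
    eval (quotient r w) , (eval q , (q , λ _ → refl) , λ x → cong (_+ eval q x) (*-identityˡ _)) , f≡factor
    where
    w = 1# ∷ a′ ∷ as
    q = quotient r ((a′ + r * 1#) ∷ as)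
    eval-w : ∀ x → eval w x ≡ f x
    eval-w x = trans (cong₂ _+_ (*-identityˡ _) (eval≡g x)) (sym (f≡ x))
    f≡factor : ∀ x → f x ≡ (x - r) * eval (quotient r w) x + f r
    f≡factor x = trans (sym (eval-w x))
      (trans (eval-division r w x) (cong ((x - r) * eval (quotient r w) x +_) (trans (remainder≡eval r w) (eval-w r))))

  monic-roots≤ : ∀ {D f} → Monic D f → ∀ {rs} → Unique rs → All (λ r → f r ≡ 0#) rs → length rs ≤ D
  monic-roots≤ _ {[]} _ _ = z≤n
  monic-roots≤ {zero} {f} (g , ([] , 0≡g) , f≡) {r ∷ _} _ (fr≡0 ∷ _) =
    contradiction (trans (sym (trans (f≡ r) (trans (cong (1# +_) (sym (0≡g r))) (+-identityʳ 1#)))) fr≡0) 1≢0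
  monic-roots≤ {suc D} {f} monic {r ∷ rs} (r∉rs ∷ u) (fr≡0 ∷ frs≡0) with monic-factor monic r
  ... | h , monic-h , f≡ = s≤s (monic-roots≤ monic-h u (All.zipWith (λ (r≢r′ , fr′≡0) → root-of-h r≢r′ fr′≡0) (r∉rs , frs≡0)))
    where
    root-of-h : ∀ {r′} → r ≢ r′ → f r′ ≡ 0# → h r′ ≡ 0#
    root-of-h {r′} r≢r′ fr′≡0
      with x*y≡0⇒x≡0∨y≡0 (trans (sym (+-identityʳ _)) (trans (cong ((r′ - r) * h r′ +_) (sym fr≡0)) (trans (sym (f≡ r′)) fr′≡0)))
    ... | inj₁ r′-r≡0 = contradiction (sym (x-y≡0⇒x≡y r′-r≡0)) r≢r′
    ... | inj₂ hr′≡0 = hr′≡0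

  Poly<-cong : ∀ {D f g} → Poly< D f → (∀ x → f x ≡ g x) → Poly< D g
  Poly<-cong (v , eval≡f) f≗g = v , λ x → trans (eval≡f x) (f≗g x)

  Poly<-∷ : ∀ {D f} c → Poly< D f → Poly< (suc D) (λ x → c * x ^ D + f x)
  Poly<-∷ c (v , eval≡f) = c ∷ v , λ x → cong (c * _ +_) (eval≡f x)

  Poly<-0 : ∀ D → Poly< D (λ _ → 0#)
  Poly<-0 zero = [] , λ _ → refl
  Poly<-0 (suc D) = Poly<-cong (Poly<-∷ 0# (Poly<-0 D)) (λ x → trans (+-identityʳ _) (zeroˡ _))

  Poly<-+ : ∀ {D f g} → Poly< D f → Poly< D g → Poly< D (λ x → f x + g x)
  Poly<-+ (v , eval≡f) (w , eval≡g) = Vec.zipWith _+_ v w , λ x → trans (eval-+ v w x) (cong₂ _+_ (eval≡f x) (eval≡g x))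
    where
    eval-+ : ∀ {D} (v w : Vec Carrier D) x → eval (Vec.zipWith _+_ v w) x ≡ eval v x + eval w x
    eval-+ [] [] x = sym (+-identityˡ 0#)
    eval-+ {suc D} (a ∷ v) (b ∷ w) x = trans (cong ((a + b) * x ^ D +_) (eval-+ v w x))
      (solve 5 (λ a b X V W → (a :+ b) :* X :+ (V :+ W) := a :* X :+ V :+ (b :* X :+ W)) refl a b (x ^ D) (eval v x) (eval w x))

  Poly<-* : ∀ {D f} c → Poly< D f → Poly< D (λ x → c * f x)
  Poly<-* c (v , eval≡f) = Vec.map (c *_) v , λ x → trans (eval-* v x) (cong (c *_) (eval≡f x))
    where
    eval-* : ∀ {D} (v : Vec Carrier D) x → eval (Vec.map (c *_) v) x ≡ c * eval v x
    eval-* [] x = sym (zeroʳ c)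
    eval-* {suc D} (a ∷ v) x = trans (cong (c * a * x ^ D +_) (eval-* v x))
      (solve 4 (λ c a X V → c :* a :* X :+ c :* V := c :* (a :* X :+ V)) refl c a (x ^ D) (eval v x))

  Poly<-neg : ∀ {D f} → Poly< D f → Poly< D (λ x → - f x)
  Poly<-neg {f = f} p = Poly<-cong (Poly<-* (- 1#) p) (λ x → -1*x≈-x (f x))

  Poly<-^ : ∀ {D} e → e < D → Poly< D (_^ e)
  Poly<-^ {suc D} e e<1+D with e ℕ.≟ D
  ... | yes refl = Poly<-cong (Poly<-∷ 1# (Poly<-0 D)) (λ x → trans (+-identityʳ _) (*-identityˡ _))
  ... | no e≢D = Poly<-cong (Poly<-∷ 0# (Poly<-^ e (ℕ.≤∧≢⇒< (ℕ.≤-pred e<1+D) e≢D)))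
                            (λ x → trans (cong (_+ x ^ e) (zeroˡ _)) (+-identityˡ _))

  Poly<-const : ∀ {D} c → 0 < D → Poly< D (λ _ → c)
  Poly<-const c 0<D = Poly<-cong (Poly<-* c (Poly<-^ 0 0<D)) (λ _ → *-identityʳ c)

  Poly<-∑ : ∀ {D} m {fs : Fin m → Carrier → Carrier} → (∀ i → Poly< D (fs i)) → Poly< D (λ x → ∑ m (λ i → fs i x))
  Poly<-∑ {D} zero _ = Poly<-0 D
  Poly<-∑ (suc m) polys = Poly<-+ (polys Fin.zero) (Poly<-∑ m (λ i → polys (Fin.suc i)))

  solutions-of-x^D≡c≤D : ∀ {D} → 0 < D → ∀ c {rs} → Unique rs → All (λ r → r ^ D ≡ c) rs → length rs ≤ D
  solutions-of-x^D≡c≤D {D} 0<D c u solutions =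
    monic-roots≤ ((λ _ → - c) , Poly<-neg (Poly<-const c 0<D) , λ x → refl) u
                 (All.map (λ r^D≡c → trans (cong (_- c) r^D≡c) (-‿inverseʳ c)) solutions)

module Trace (F : FiniteField) {q n : ℕ} (1<q : 1 < q) (q-additive : FieldBasics.Additive F q)
             (order≡q^n : FiniteField.order F ≡ q ℕ.^ n) where

  open FieldBasics F

  private
    0<q : 0 < q
    0<q = ℕ.<-trans (s≤s z≤n) 1<q

    0<q^i : ∀ i → 0 < q ℕ.^ i
    0<q^i i = ℕ.m^n>0 q {{ℕ.>-nonZero 0<q}} i

    q^i-additive : ∀ i → Additive (q ℕ.^ i)
    q^i-additive = Additive-^ {q} q-additive

  InFq-^ : ∀ {c} → InFq q c → ∀ i → c ^ (q ℕ.^ i) ≡ c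
  InFq-^ {c} _ zero = *-identityʳ c
  InFq-^ {c} c∈Fq (suc i) = trans (sym (^-*-assoc c q (q ℕ.^ i))) (trans (cong (_^ (q ℕ.^ i)) c∈Fq) (InFq-^ c∈Fq i))

  InFq-* : ∀ {a b} → InFq q a → InFq q b → InFq q (a * b)
  InFq-* {a} {b} a∈Fq b∈Fq = trans (^-distribʳ-* a b q) (cong₂ _*_ a∈Fq b∈Fq)

  InFq-+ : ∀ {a b} → InFq q a → InFq q b → InFq q (a + b)
  InFq-+ {a} {b} a∈Fq b∈Fq = trans (q-additive a b) (cong₂ _+_ a∈Fq b∈Fq)

  InFq-neg : ∀ {a} → InFq q a → InFq q (- a)
  InFq-neg {a} a∈Fq = trans (Additive-neg 0<q q-additive a) (cong -_ a∈Fq)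

  InFq-0 : InFq q 0#
  InFq-0 = 0^n≡0 0<q

  InFq-1 : InFq q 1#
  InFq-1 = 1^n≡1 q

  InFq-inv : ∀ {a} (a≢0 : a ≢ 0#) → InFq q a → InFq q (inv a a≢0)
  InFq-inv {a} a≢0 a∈Fq = *-cancelˡ (^-≢0 q a≢0) (begin
    a ^ q * inv a a≢0 ^ q   ≡⟨ sym (^-distribʳ-* a (inv a a≢0) q) ⟩
    (a * inv a a≢0) ^ q     ≡⟨ trans (cong (_^ q) (*-inverseʳ a a≢0)) (1^n≡1 q) ⟩
    1#                      ≡⟨ sym (*-inverseʳ a a≢0) ⟩
    a * inv a a≢0           ≡⟨ cong (_* inv a a≢0) (sym a∈Fq) ⟩
    a ^ q * inv a a≢0       ∎)
    where open ≡-Reasoning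

  ∑-cong : ∀ m {f g : Fin m → Carrier} → (∀ i → f i ≡ g i) → ∑ m f ≡ ∑ m g
  ∑-cong zero _ = refl
  ∑-cong (suc m) f≗g = cong₂ _+_ (f≗g Fin.zero) (∑-cong m (λ i → f≗g (Fin.suc i)))

  ∑-+ : ∀ m (f g : Fin m → Carrier) → ∑ m (λ i → f i + g i) ≡ ∑ m f + ∑ m g
  ∑-+ zero f g = sym (+-identityˡ 0#)
  ∑-+ (suc m) f g = trans (cong (f Fin.zero + g Fin.zero +_) (∑-+ m (λ i → f (Fin.suc i)) (λ i → g (Fin.suc i))))
    (solve 4 (λ a b A B → a :+ b :+ (A :+ B) := a :+ A :+ (b :+ B)) refl (f Fin.zero) (g Fin.zero) _ _)

  ∑-* : ∀ m c (f : Fin m → Carrier) → ∑ m (λ i → c * f i) ≡ c * ∑ m f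
  ∑-* zero c f = sym (zeroʳ c)
  ∑-* (suc m) c f = trans (cong (c * f Fin.zero +_) (∑-* m c (λ i → f (Fin.suc i)))) (sym (distribˡ _ _ _))

  ∑-neg : ∀ m (f : Fin m → Carrier) → ∑ m (λ i → - f i) ≡ - ∑ m f
  ∑-neg m f = trans (∑-cong m (λ i → sym (-1*x≈-x (f i)))) (trans (∑-* m (- 1#) f) (-1*x≈-x _))

  ∑-0 : ∀ m → ∑ m (λ _ → 0#) ≡ 0#
  ∑-0 zero = refl
  ∑-0 (suc m) = trans (+-identityˡ _) (∑-0 m)

  ∑-last : ∀ m (f : Fin (suc m) → Carrier) → ∑ (suc m) f ≡ ∑ m (λ i → f (inject₁ i)) + f (fromℕ m)
  ∑-last zero f = trans (+-identityʳ _) (sym (+-identityˡ _))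
  ∑-last (suc m) f = trans (cong (f Fin.zero +_) (∑-last m (λ i → f (Fin.suc i)))) (sym (+-assoc _ _ _))

  ∑-^ : ∀ {e} → 0 < e → Additive e → ∀ m (f : Fin m → Carrier) → (∑ m f) ^ e ≡ ∑ m (λ i → f i ^ e)
  ∑-^ 0<e _ zero f = 0^n≡0 0<e
  ∑-^ {e} 0<e additive (suc m) f = trans (additive _ _) (cong (f Fin.zero ^ e +_) (∑-^ 0<e additive m (λ i → f (Fin.suc i))))

  ∑-shift : ∀ m (h : ℕ → Carrier) → ∑ m (λ i → h (suc (toℕ i))) + h 0 ≡ ∑ m (λ i → h (toℕ i)) + h m
  ∑-shift zero h = refl
  ∑-shift (suc m) h = begin
    h 1 + S′ + h 0        ≡⟨ cong (_+ h 0) (+-comm _ _) ⟩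
    S′ + h 1 + h 0        ≡⟨ cong (_+ h 0) (∑-shift m (λ j → h (suc j))) ⟩
    S + h (suc m) + h 0   ≡⟨ solve 3 (λ a b c → a :+ b :+ c := c :+ a :+ b) refl S (h (suc m)) (h 0) ⟩
    h 0 + S + h (suc m)   ∎
    where
    open ≡-Reasoning
    S′ = ∑ m (λ i → h (suc (suc (toℕ i))))
    S = ∑ m (λ i → h (suc (toℕ i)))

  Tr-+ : ∀ x y → Tr q n (x + y) ≡ Tr q n x + Tr q n y
  Tr-+ x y = trans (∑-cong n (λ i → q^i-additive (toℕ i) x y)) (∑-+ n _ _)

  Tr-* : ∀ {c} → InFq q c → ∀ x → Tr q n (c * x) ≡ c * Tr q n x
  Tr-* {c} c∈Fq x = trans (∑-cong n c^qⁱxᵢ≡cxᵢ) (∑-* n c _)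
    where
    c^qⁱxᵢ≡cxᵢ : ∀ i → (c * x) ^ (q ℕ.^ toℕ i) ≡ c * x ^ (q ℕ.^ toℕ i)
    c^qⁱxᵢ≡cxᵢ i = trans (^-distribʳ-* c x (q ℕ.^ toℕ i)) (cong (_* x ^ (q ℕ.^ toℕ i)) (InFq-^ c∈Fq (toℕ i)))

  Tr-0 : Tr q n 0# ≡ 0#
  Tr-0 = trans (∑-cong n (λ i → 0^n≡0 (0<q^i (toℕ i)))) (∑-0 n)

  Tr-neg : ∀ x → Tr q n (- x) ≡ - Tr q n x
  Tr-neg x = trans (cong (Tr q n) (sym (-1*x≈-x x))) (trans (Tr-* (InFq-neg InFq-1) x) (-1*x≈-x _))

  Tr-- : ∀ x y → Tr q n (x - y) ≡ Tr q n x - Tr q n y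
  Tr-- x y = trans (Tr-+ x (- y)) (cong (Tr q n x +_) (Tr-neg y))

  Tr-∑ : ∀ m (f : Fin m → Carrier) → Tr q n (∑ m f) ≡ ∑ m (λ i → Tr q n (f i))
  Tr-∑ zero f = Tr-0
  Tr-∑ (suc m) f = trans (Tr-+ _ _) (cong (Tr q n (f Fin.zero) +_) (Tr-∑ m (λ i → f (Fin.suc i))))

  -- Raising to the q-th power shifts the conjugates x ^ q ^ i cyclically, since x ^ q ^ n ≡ x.
  Tr∈Fq : ∀ x → InFq q (Tr q n x)
  Tr∈Fq x = begin
    Tr q n x ^ q                             ≡⟨ ∑-^ 0<q q-additive n _ ⟩
    ∑ n (λ i → (x ^ (q ℕ.^ toℕ i)) ^ q)      ≡⟨ ∑-cong n (λ i → trans (^-*-assoc x (q ℕ.^ toℕ i) q) (cong (x ^_) (ℕ.*-comm (q ℕ.^ toℕ i) q))) ⟩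
    ∑ n (λ i → h (suc (toℕ i)))              ≡⟨ +-cancelʳ (trans (∑-shift n h) (cong (Tr q n x +_) h[n]≡h[0])) ⟩
    Tr q n x                                 ∎
    where
    open ≡-Reasoning
    h : ℕ → Carrier
    h j = x ^ (q ℕ.^ j)
    h[n]≡h[0] : h n ≡ h 0
    h[n]≡h[0] = trans (cong (x ^_) (sym order≡q^n)) (trans (x^order≡x x) (sym (*-identityʳ x)))
    +-cancelʳ : ∀ {a b} → a + h 0 ≡ b + h 0 → a ≡ b
    +-cancelʳ {a} {b} eq = x-y≡0⇒x≡y (trans (solve 3 (λ a b c → a :- b := a :+ c :- (b :+ c)) refl a b (h 0))
                                              (trans (cong (_- (b + h 0)) eq) (-‿inverseʳ _)))

  open UniqueList _≟_

  Fq-elements : List Carrier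
  Fq-elements = filter (λ x → x ^ q ≟ x) elements

  Unique-Fq-elements : Unique Fq-elements
  Unique-Fq-elements = Unique.filter⁺ _ elements-unique

  ∈-Fq-elements⁺ : ∀ {x} → InFq q x → x ∈ Fq-elements
  ∈-Fq-elements⁺ {x} x∈Fq = ∈-filter⁺ (λ x → x ^ q ≟ x) (elements-complete x) x∈Fq

  ∈-Fq-elements⁻ : ∀ {x} → x ∈ Fq-elements → InFq q x
  ∈-Fq-elements⁻ x∈ = proj₂ (∈-filter⁻ (λ x → x ^ q ≟ x) {xs = elements} x∈)

  |Fq|≤q : length Fq-elements ≤ q
  |Fq|≤q = Polynomials.monic-roots≤ F ((λ x → - x) , x^1-poly , λ x → refl) Unique-Fq-elements
    (All.tabulate (λ x∈ → trans (cong (_- _) (∈-Fq-elements⁻ x∈)) (-‿inverseʳ _)))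
    where
    open Polynomials F using (Poly<-cong; Poly<-neg; Poly<-^)
    x^1-poly = Poly<-cong (Poly<-neg (Poly<-^ 1 1<q)) (λ x → cong -_ (*-identityʳ x))

  Tr-collision : ∀ bs L → Unique L → length Fq-elements ℕ.^ length bs < length L →
                 ∃[ x ] ∃[ y ] (x ∈ L × y ∈ L × x ≢ y × All (λ b → Tr q n (x * b) ≡ Tr q n (y * b)) bs)
  Tr-collision [] (x ∷ y ∷ _) ((x≢y ∷ _) ∷ _) _ = x , y , here refl , there (here refl) , x≢y , []
  Tr-collision [] (_ ∷ []) _ (s≤s ())
  Tr-collision (b ∷ bs) L u big
    with pigeonhole (λ x → Tr q n (x * b)) _ Fq-elements L u (λ {x} _ → ∈-Fq-elements⁺ (Tr∈Fq (x * b))) big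
  ... | _ , M , uM , M⊆L , fibre , M-big with Tr-collision bs M uM M-big
  ...   | x , y , x∈M , y∈M , x≢y , collisions =
    x , y , M⊆L x∈M , M⊆L y∈M , x≢y , trans (All.lookup fibre x∈M) (sym (All.lookup fibre y∈M)) ∷ collisions

  module _ {n′ : ℕ} (n≡1+n′ : n ≡ suc n′) where

    open Polynomials F using (Poly<-+; Poly<-∑; Poly<-^; Poly<-neg; Poly<-const; monic-roots≤)

    private
      order≡q*q^n′ : order ≡ q ℕ.* q ℕ.^ n′
      order≡q*q^n′ = trans order≡q^n (cong (q ℕ.^_) n≡1+n′)

      q^n′<order : q ℕ.^ n′ < order
      q^n′<order = subst (q ℕ.^ n′ <_) (sym order≡q*q^n′)
        (subst (_< q ℕ.* q ℕ.^ n′) (ℕ.*-identityˡ _) (ℕ.*-monoˡ-< (q ℕ.^ n′) {{ℕ.>-nonZero (0<q^i n′)}} 1<q))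

    -- Tr is monic of degree q ^ n′ (its top conjugate), so each value is taken at most q ^ n′ times.
    Tr≡c-solutions≤ : ∀ c {rs} → Unique rs → All (λ r → Tr q n r ≡ c) rs → length rs ≤ q ℕ.^ n′
    Tr≡c-solutions≤ c u solutions = monic-roots≤ (lower , lower-poly , Tr-c≡) u
      (All.map (λ Tr≡c → trans (cong (_- c) Tr≡c) (-‿inverseʳ c)) solutions)
      where
      lower : Carrier → Carrier
      lower x = ∑ n′ (λ i → x ^ (q ℕ.^ toℕ i)) - c
      lower-poly = Poly<-+ (Poly<-∑ n′ (λ i → Poly<-^ (q ℕ.^ toℕ i) (ℕ.^-monoʳ-< q 1<q (Fin.toℕ<n i))))
                           (Poly<-neg (Poly<-const c (0<q^i n′)))
      Tr-c≡ : ∀ x → Tr q n x - c ≡ x ^ (q ℕ.^ n′) + lower x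
      Tr-c≡ x = begin
        Tr q n x - c                                                    ≡⟨ cong (λ m → Tr q m x - c) n≡1+n′ ⟩
        ∑ (suc n′) (λ i → x ^ (q ℕ.^ toℕ i)) - c                        ≡⟨ cong (_- c) (∑-last n′ (λ i → x ^ (q ℕ.^ toℕ i))) ⟩
        ∑ n′ (λ i → x ^ (q ℕ.^ toℕ (inject₁ i))) + x ^ (q ℕ.^ toℕ (fromℕ n′)) - c
          ≡⟨ cong₂ (λ S e → S + x ^ (q ℕ.^ e) - c) (∑-cong n′ (λ i → cong (λ j → x ^ (q ℕ.^ j)) (Fin.toℕ-inject₁ i))) (Fin.toℕ-fromℕ n′) ⟩
        ∑ n′ (λ i → x ^ (q ℕ.^ toℕ i)) + x ^ (q ℕ.^ n′) - c             ≡⟨ solve 3 (λ S X c → S :+ X :- c := X :+ (S :- c)) refl _ _ c ⟩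
        x ^ (q ℕ.^ n′) + lower x                                        ∎
        where open ≡-Reasoning

    -- Tr maps F onto F_q with fibres of size at most q ^ n′, so q * q ^ n′ ≤ |F_q| * q ^ n′.
    |Fq|≡q : length Fq-elements ≡ q
    |Fq|≡q = ℕ.≤-antisym |Fq|≤q q≤|Fq|
      where
      q≤|Fq| : q ≤ length Fq-elements
      q≤|Fq| with length Fq-elements ℕ.<? q
      ... | no |Fq|≮q = ℕ.≮⇒≥ |Fq|≮q
      ... | yes |Fq|<q with pigeonhole (Tr q n) (q ℕ.^ n′) Fq-elements elements elements-unique (λ {x} _ → ∈-Fq-elements⁺ (Tr∈Fq x))
                              (ℕ.<-≤-trans (ℕ.*-monoˡ-< (q ℕ.^ n′) {{ℕ.>-nonZero (0<q^i n′)}} |Fq|<q) (ℕ.≤-reflexive (sym order≡q*q^n′)))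
      ...   | c , fibre , u , _ , fibre≡c , fibre-big = contradiction (Tr≡c-solutions≤ c u fibre≡c) (ℕ.<⇒≱ fibre-big)

    Tr-nonzero : ∃[ x ] (Tr q n x ≢ 0#)
    Tr-nonzero with any? (λ x → ¬? (Tr q n x ≟ 0#)) elements
    ... | yes some = let (x , _ , Trx≢0) = find some in x , Trx≢0
    ... | no none = contradiction (Tr≡c-solutions≤ 0# elements-unique (All.map (decidable-stable (_ ≟ _)) (¬Any⇒All¬ elements none)))
                                  (ℕ.<⇒≱ q^n′<order)

    nonzero-Tr-annihilator : (b : Fin n′ → Carrier) → ∃[ β ] (β ≢ 0# × (∀ i → Tr q n (β * b i) ≡ 0#))
    nonzero-Tr-annihilator b
      with Tr-collision (tabulate b) elements elements-unique
             (subst₂ (λ m l → m ℕ.^ l < order) (sym |Fq|≡q) (sym (length-tabulate b)) q^n′<order)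
    ... | x , y , _ , _ , x≢y , collisions =
      x - y , (λ x-y≡0 → x≢y (x-y≡0⇒x≡y x-y≡0)) , λ i → begin
        Tr q n ((x - y) * b i)                   ≡⟨ cong (Tr q n) (solve 3 (λ x y b → (x :- y) :* b := x :* b :- y :* b) refl x y (b i)) ⟩
        Tr q n (x * b i - y * b i)               ≡⟨ Tr-- (x * b i) (y * b i) ⟩
        Tr q n (x * b i) - Tr q n (y * b i)      ≡⟨ cong (_- Tr q n (y * b i)) (All.lookup collisions (∈-tabulate⁺ i)) ⟩
        Tr q n (y * b i) - Tr q n (y * b i)      ≡⟨ -‿inverseʳ _ ⟩
        0#                                       ∎
      where open ≡-Reasoning

module Hyperplane (F : FiniteField) {q n′ : ℕ} (1<q : 1 < q) (q-additive : FieldBasics.Additive F q)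
                  (order≡q^n : FiniteField.order F ≡ q ℕ.^ suc n′)
                  {U : Pred (FiniteField.Carrier F) 0ℓ} {x₀ : FiniteField.Carrier F} (x₀∉U : ¬ U x₀)
                  (dim-U : FiniteField.HasDim F q U n′) where

  open FieldBasics F
  open Trace F {q} {suc n′} 1<q q-additive order≡q^n
  open UniqueList _≟_

  private
    n = suc n′

  b : Fin n′ → Carrier
  b = proj₁ dim-U

  b-independent : ∀ c → (∀ i → InFq q (c i)) → ∑ n′ (λ i → c i * b i) ≡ 0# → ∀ i → c i ≡ 0#
  b-independent = proj₁ (proj₂ dim-U)

  b-spans : ∀ x → U x ⇔ (Σ (Fin n′ → Carrier) λ c → (∀ i → InFq q (c i)) × x ≡ ∑ n′ (λ i → c i * b i))
  b-spans = proj₂ (proj₂ dim-U)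

  lin : (Fin n′ → Carrier) → Carrier
  lin c = ∑ n′ (λ i → c i * b i)

  lin-- : ∀ c d → lin c - lin d ≡ lin (λ i → c i - d i)
  lin-- c d = begin
    lin c - lin d                               ≡⟨ cong (lin c +_) (sym (∑-neg n′ _)) ⟩
    lin c + ∑ n′ (λ i → - (d i * b i))          ≡⟨ sym (∑-+ n′ _ _) ⟩
    ∑ n′ (λ i → c i * b i + - (d i * b i))      ≡⟨ ∑-cong n′ (λ i → solve 3 (λ c d b → c :* b :+ :- (d :* b) := (c :- d) :* b) refl (c i) (d i) (b i)) ⟩
    lin (λ i → c i - d i)                       ∎
    where open ≡-Reasoning

  lin-* : ∀ a c → a * lin c ≡ lin (λ i → a * c i)
  lin-* a c = trans (sym (∑-* n′ a _)) (∑-cong n′ (λ i → sym (*-assoc _ _ _)))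

  combination : Vec Carrier n → Carrier
  combination (c₀ ∷ cs) = c₀ * x₀ + lin (lookup cs)

  InFqⁿ : ∀ {l} → Vec Carrier l → Set
  InFqⁿ v = ∀ i → InFq q (lookup v i)

  -- x₀ is not in the F_q-span of b, so (x₀ , b) is F_q-linearly independent.
  combination-injective : ∀ {v w} → InFqⁿ v → InFqⁿ w → combination v ≡ combination w → v ≡ w
  combination-injective {c₀ ∷ cs} {d₀ ∷ ds} v∈Fqⁿ w∈Fqⁿ eq with c₀ - d₀ ≟ 0#
  ... | no δ≢0 = contradiction (Equivalence.from (b-spans x₀) (coefficients , coefficients∈Fq , x₀≡lin)) x₀∉U
    where
    δ = c₀ - d₀
    coefficients : Fin n′ → Carrier
    coefficients i = inv δ δ≢0 * (lookup ds i - lookup cs i)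
    coefficients∈Fq : ∀ i → InFq q (coefficients i)
    coefficients∈Fq i = InFq-* (InFq-inv δ≢0 (InFq-+ (v∈Fqⁿ Fin.zero) (InFq-neg (w∈Fqⁿ Fin.zero))))
                               (InFq-+ (w∈Fqⁿ (Fin.suc i)) (InFq-neg (v∈Fqⁿ (Fin.suc i))))
    δx₀≡ : δ * x₀ ≡ lin (lookup ds) - lin (lookup cs)
    δx₀≡ = begin
      δ * x₀                                              ≡⟨ solve 4 (λ c d x L → (c :- d) :* x := c :* x :+ L :- L :- d :* x) refl c₀ d₀ x₀ (lin (lookup cs)) ⟩
      combination (c₀ ∷ cs) - lin (lookup cs) - d₀ * x₀   ≡⟨ cong (λ z → z - lin (lookup cs) - d₀ * x₀) eq ⟩
      combination (d₀ ∷ ds) - lin (lookup cs) - d₀ * x₀   ≡⟨ solve 4 (λ d x L M → d :* x :+ M :- L :- d :* x := M :- L) refl d₀ x₀ (lin (lookup cs)) (lin (lookup ds)) ⟩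
      lin (lookup ds) - lin (lookup cs)                   ∎
      where open ≡-Reasoning
    x₀≡lin : x₀ ≡ lin coefficients
    x₀≡lin = begin
      x₀                                                  ≡⟨ sym (trans (cong (_* x₀) (*-inverseˡ δ δ≢0)) (*-identityˡ x₀)) ⟩
      inv δ δ≢0 * δ * x₀                                  ≡⟨ *-assoc _ _ _ ⟩
      inv δ δ≢0 * (δ * x₀)                                ≡⟨ cong (inv δ δ≢0 *_) (trans δx₀≡ (lin-- (lookup ds) (lookup cs))) ⟩
      inv δ δ≢0 * lin (λ i → lookup ds i - lookup cs i)   ≡⟨ lin-* _ _ ⟩
      lin coefficients                                    ∎
      where open ≡-Reasoning
  ... | yes δ≡0 = cong₂ _∷_ c₀≡d₀ (lookup-injective (λ i → x-y≡0⇒x≡y (b-independent _ differences∈Fq lin-differences≡0 i)))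
    where
    c₀≡d₀ = x-y≡0⇒x≡y δ≡0
    differences∈Fq : ∀ i → InFq q (lookup cs i - lookup ds i)
    differences∈Fq i = InFq-+ (v∈Fqⁿ (Fin.suc i)) (InFq-neg (w∈Fqⁿ (Fin.suc i)))
    lin-differences≡0 : lin (λ i → lookup cs i - lookup ds i) ≡ 0#
    lin-differences≡0 = begin
      lin (λ i → lookup cs i - lookup ds i)               ≡⟨ sym (lin-- (lookup cs) (lookup ds)) ⟩
      lin (lookup cs) - lin (lookup ds)                   ≡⟨ solve 3 (λ a L M → L :- M := a :+ L :- (a :+ M)) refl (c₀ * x₀) _ _ ⟩
      combination (c₀ ∷ cs) - (c₀ * x₀ + lin (lookup ds)) ≡⟨ cong₂ (λ z c → z - (c * x₀ + lin (lookup ds))) eq c₀≡d₀ ⟩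
      combination (d₀ ∷ ds) - combination (d₀ ∷ ds)       ≡⟨ -‿inverseʳ _ ⟩
      0#                                                  ∎
      where open ≡-Reasoning
    lookup-injective : ∀ {l} {v w : Vec Carrier l} → (∀ i → lookup v i ≡ lookup w i) → v ≡ w
    lookup-injective {v = v} {w} v≗w = trans (sym (Vec.tabulate∘lookup v)) (trans (Vec.tabulate-cong v≗w) (Vec.tabulate∘lookup w))

  private
    ∈Fqⁿ : ∀ {v} → v ∈ vectors Fq-elements n → InFqⁿ v
    ∈Fqⁿ v∈ i = ∈-Fq-elements⁻ (∈-vectors⁻ v∈ i)

    combinations : List Carrier
    combinations = map combination (vectors Fq-elements n)

    Unique-combinations : Unique combinations
    Unique-combinations = Unique-map⁺-on (Unique-vectors Unique-Fq-elements n)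
                                         (λ v∈ w∈ → combination-injective (∈Fqⁿ v∈) (∈Fqⁿ w∈))

    |combinations|≡order : length combinations ≡ order
    |combinations|≡order = trans (length-map combination (vectors Fq-elements n)) (trans (length-vectors Fq-elements n)
                                 (trans (cong (ℕ._^ n) (|Fq|≡q refl)) (sym order≡q^n)))

  -- The q ^ n distinct combinations exhaust F.
  decomposition : ∀ y → ∃[ c₀ ] ∃[ c ] (InFq q c₀ × (∀ i → InFq q (c i)) × y ≡ c₀ * x₀ + lin c)
  decomposition y with ∈-map⁻ combination (Unique-⊆-length≥⇒⊇ Unique-combinations (λ {z} _ → elements-complete z)
                                             (ℕ.≤-reflexive (sym |combinations|≡order)) (elements-complete y))
  ... | c₀ ∷ cs , v∈ , y≡ = c₀ , lookup cs , ∈Fqⁿ v∈ Fin.zero , (λ i → ∈Fqⁿ v∈ (Fin.suc i)) , y≡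

  opaque
    β-pack : ∃[ β ] (β ≢ 0# × (∀ i → Tr q n (β * b i) ≡ 0#))
    β-pack = nonzero-Tr-annihilator refl b

  β : Carrier
  β = proj₁ β-pack

  β≢0 : β ≢ 0#
  β≢0 = proj₁ (proj₂ β-pack)

  Tr-β-lin : ∀ c → (∀ i → InFq q (c i)) → Tr q n (β * lin c) ≡ 0#
  Tr-β-lin c c∈Fq = begin
    Tr q n (β * lin c)                    ≡⟨ cong (Tr q n) (trans (lin-* β c) (∑-cong n′ (λ i → solve 3 (λ β c b → β :* c :* b := c :* (β :* b)) refl β (c i) (b i)))) ⟩
    Tr q n (∑ n′ (λ i → c i * (β * b i))) ≡⟨ Tr-∑ n′ _ ⟩
    ∑ n′ (λ i → Tr q n (c i * (β * b i))) ≡⟨ ∑-cong n′ (λ i → trans (Tr-* (c∈Fq i) _) (trans (cong (c i *_) (proj₂ (proj₂ β-pack) i)) (zeroʳ _))) ⟩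
    ∑ n′ (λ _ → 0#)                       ≡⟨ ∑-0 n′ ⟩
    0#                                    ∎
    where open ≡-Reasoning

  Tr-β-combination : ∀ c₀ c → InFq q c₀ → (∀ i → InFq q (c i)) → Tr q n (β * (c₀ * x₀ + lin c)) ≡ c₀ * Tr q n (β * x₀)
  Tr-β-combination c₀ c c₀∈Fq c∈Fq = begin
    Tr q n (β * (c₀ * x₀ + lin c))               ≡⟨ cong (Tr q n) (solve 4 (λ β c x L → β :* (c :* x :+ L) := c :* (β :* x) :+ β :* L) refl β c₀ x₀ (lin c)) ⟩
    Tr q n (c₀ * (β * x₀) + β * lin c)           ≡⟨ Tr-+ _ _ ⟩
    Tr q n (c₀ * (β * x₀)) + Tr q n (β * lin c)  ≡⟨ cong₂ _+_ (Tr-* c₀∈Fq _) (Tr-β-lin c c∈Fq) ⟩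
    c₀ * Tr q n (β * x₀) + 0#                    ≡⟨ +-identityʳ _ ⟩
    c₀ * Tr q n (β * x₀)                         ∎
    where open ≡-Reasoning

  -- Otherwise Tr (β * y) would vanish for every y, by decomposition, but Tr is not identically zero.
  Tr-βx₀≢0 : Tr q n (β * x₀) ≢ 0#
  Tr-βx₀≢0 Tr-βx₀≡0 = proj₂ (Tr-nonzero refl) (trans (cong (Tr q n) (sym β[β⁻¹z]≡z)) (Tr-β≡0 (inv β β≢0 * z)))
    where
    z = proj₁ (Tr-nonzero refl)
    β[β⁻¹z]≡z : β * (inv β β≢0 * z) ≡ z
    β[β⁻¹z]≡z = trans (sym (*-assoc _ _ _)) (trans (cong (_* z) (*-inverseʳ β β≢0)) (*-identityˡ z))
    Tr-β≡0 : ∀ y → Tr q n (β * y) ≡ 0#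
    Tr-β≡0 y with decomposition y
    ... | c₀ , c , c₀∈Fq , c∈Fq , refl = trans (Tr-β-combination c₀ c c₀∈Fq c∈Fq) (trans (cong (c₀ *_) Tr-βx₀≡0) (zeroʳ c₀))

  U⇔Tr-β≡0 : ∀ y → U y ⇔ Tr q n (β * y) ≡ 0#
  U⇔Tr-β≡0 y = mk⇔ to from
    where
    to : U y → Tr q n (β * y) ≡ 0#
    to Uy with Equivalence.to (b-spans y) Uy
    ... | c , c∈Fq , refl = Tr-β-lin c c∈Fq
    from : Tr q n (β * y) ≡ 0# → U y
    from Tr-βy≡0 with decomposition y
    ... | c₀ , c , c₀∈Fq , c∈Fq , refl with x*y≡0⇒x≡0∨y≡0 (trans (sym (Tr-β-combination c₀ c c₀∈Fq c∈Fq)) Tr-βy≡0)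
    ...   | inj₂ Tr-βx₀≡0 = contradiction Tr-βx₀≡0 Tr-βx₀≢0
    ...   | inj₁ c₀≡0 = Equivalence.from (b-spans _) (c , c∈Fq , trans (cong (λ z → z * x₀ + lin c) c₀≡0)
                                                             (trans (cong (_+ lin c) (zeroˡ x₀)) (+-identityˡ _)))

module Squares (F : FiniteField) where

  open FieldBasics F
  open Polynomials F using (solutions-of-x^D≡c≤D)
  open UniqueList _≟_

  IsSquare : Carrier → Set
  IsSquare z = ∃[ a ] (a * a ≡ z)

  square? : ∀ z → Dec (IsSquare z)
  square? z with any? (λ a → a * a ≟ z) elements
  ... | yes some = yes (let (a , _ , a²≡z) = find some in a , a²≡z)
  ... | no none = no λ (a , a²≡z) → none (Any.map (λ { refl → a²≡z }) (elements-complete a))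

  x*x≡x^2 : ∀ x → x * x ≡ x ^ 2
  x*x≡x^2 x = cong (x *_) (sym (*-identityʳ x))

  -- Squaring is injective when 1# + 1# ≡ 0#, since then (x + y) ^ 2 ≡ x ^ 2 + y ^ 2.
  char2⇒square : 1# + 1# ≡ 0# → ∀ z → IsSquare z
  char2⇒square 1+1≡0 z with ∈-map⁻ (λ a → a * a)
    (Unique-⊆-length≥⇒⊇ (Unique.map⁺ squaring-injective elements-unique) (λ {w} _ → elements-complete w)
                        (ℕ.≤-reflexive (sym (length-map _ elements))) (elements-complete z))
    where
    open ≡-Reasoning
    x+x≡0 : ∀ x → x + x ≡ 0#
    x+x≡0 x = begin
      x + x              ≡⟨ cong₂ _+_ (sym (*-identityˡ x)) (sym (*-identityˡ x)) ⟩
      1# * x + 1# * x    ≡⟨ sym (distribʳ x 1# 1#) ⟩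
      (1# + 1#) * x      ≡⟨ trans (cong (_* x) 1+1≡0) (zeroˡ x) ⟩
      0#                 ∎
    squaring-injective : ∀ {x y} → x * x ≡ y * y → x ≡ y
    squaring-injective {x} {y} x²≡y² = x-y≡0⇒x≡y (trans (cong (x +_) -y≡y) (x*x≡0⇒x≡0 (begin
      (x + y) * (x + y)                ≡⟨ solve 2 (λ x y → (x :+ y) :* (x :+ y) := x :* x :+ y :* y :+ (x :* y :+ x :* y)) refl x y ⟩
      x * x + y * y + (x * y + x * y)  ≡⟨ cong₂ _+_ (trans (cong (_+ y * y) x²≡y²) (x+x≡0 _)) (x+x≡0 _) ⟩
      0# + 0#                          ≡⟨ +-identityˡ 0# ⟩
      0#                               ∎)))
      where
      -y≡y : - y ≡ y
      -y≡y = trans (sym (+-identityʳ (- y))) (trans (cong (- y +_) (sym (x+x≡0 y))) (solve 1 (λ y → :- y :+ (y :+ y) := y) refl y))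
  ... | a , _ , z≡a² = a , sym z≡a²

  w*w≡1⇒w≡±1 : ∀ {w} → w * w ≡ 1# → w ≡ 1# ⊎ w ≡ - 1#
  w*w≡1⇒w≡±1 {w} w²≡1 with x*y≡0⇒x≡0∨y≡0 {w - 1#} {w + 1#} (trans (solve 2 (λ w o → (w :- o) :* (w :+ o) := w :* w :- o :* o) refl w 1#)
                                                          (trans (cong₂ _-_ w²≡1 (*-identityˡ 1#)) (-‿inverseʳ 1#)))
  ... | inj₁ w-1≡0 = inj₁ (x-y≡0⇒x≡y w-1≡0)
  ... | inj₂ w+1≡0 = inj₂ (x-y≡0⇒x≡y (trans (solve 2 (λ w o → w :- :- o := w :+ o) refl w 1#) w+1≡0))

  nonsquare-≢0 : ∀ {z} → ¬ IsSquare z → z ≢ 0#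
  nonsquare-≢0 ¬square z≡0 = ¬square (0# , trans (zeroˡ 0#) (sym z≡0))

  module EulerCriterion {h : ℕ} (order≡1+2h : order ≡ suc (2 ℕ.* h)) where

    |F*|≡2h : length nonzeros ≡ 2 ℕ.* h
    |F*|≡2h = ℕ.suc-injective (trans (sym order≡1+|nonzeros|) order≡1+2h)

    0<h : 0 < h
    0<h = ℕ.n≢0⇒n>0 (λ h≡0 → ℕ.<⇒≢ (non-empty (∈-nonzeros⁺ 1≢0)) (sym (trans |F*|≡2h (cong (2 ℕ.*_) h≡0))))
      where
      non-empty : ∀ {x} {xs : List Carrier} → x ∈ xs → 0 < length xs
      non-empty (here _) = s≤s z≤n
      non-empty (there _) = s≤s z≤n

    z^h*z^h≡1 : ∀ {z} → z ≢ 0# → z ^ h * z ^ h ≡ 1#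
    z^h*z^h≡1 {z} z≢0 = begin
      z ^ h * z ^ h      ≡⟨ sym (^-distribˡ-+-* z h h) ⟩
      z ^ (h ℕ.+ h)      ≡⟨ cong (λ e → z ^ (h ℕ.+ e)) (sym (ℕ.+-identityʳ h)) ⟩
      z ^ (2 ℕ.* h)      ≡⟨ cong (z ^_) (sym |F*|≡2h) ⟩
      z ^ length nonzeros ≡⟨ a^|F*|≡1 z≢0 ⟩
      1#                 ∎
      where open ≡-Reasoning

    square⇒z^h≡1 : ∀ {z} → z ≢ 0# → IsSquare z → z ^ h ≡ 1#
    square⇒z^h≡1 z≢0 (a , refl) = trans (^-distribʳ-* a a h) (z^h*z^h≡1 (*≢0⇒≢0ˡ z≢0))

    nonzero-squares : List Carrier
    nonzero-squares = filter square? nonzeros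

    Unique-nonzero-squares : Unique nonzero-squares
    Unique-nonzero-squares = Unique.filter⁺ square? Unique-nonzeros

    ∈-nonzero-squares⁻ : ∀ {z} → z ∈ nonzero-squares → z ^ h ≡ 1#
    ∈-nonzero-squares⁻ z∈ with ∈-filter⁻ square? {xs = nonzeros} z∈
    ... | z∈F* , square = square⇒z^h≡1 (∈-nonzeros⁻ z∈F*) square

    -- Each nonzero square has at most two square roots, so there are at least |F*| / 2 = h of them.
    h≤|squares| : h ≤ length nonzero-squares
    h≤|squares| = ℕ.*-cancelʳ-≤ h (length nonzero-squares) 2
      (subst (_≤ length nonzero-squares ℕ.* 2) (trans |F*|≡2h (ℕ.*-comm 2 h)) |F*|≤2|squares|)
      where
      |F*|≤2|squares| : length nonzeros ≤ length nonzero-squares ℕ.* 2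
      |F*|≤2|squares| with length nonzero-squares ℕ.* 2 ℕ.<? length nonzeros
      ... | no ¬small = ℕ.≮⇒≥ ¬small
      ... | yes small with pigeonhole (λ x → x * x) 2 nonzero-squares nonzeros Unique-nonzeros
                         (λ {x} x∈ → ∈-filter⁺ square? (∈-nonzeros⁺ (*-≢0 (∈-nonzeros⁻ x∈) (∈-nonzeros⁻ x∈))) (x , refl)) small
      ...   | s , roots , u , _ , roots² , big =
        contradiction (solutions-of-x^D≡c≤D (s≤s z≤n) s u (All.map (λ x²≡s → trans (sym (x*x≡x^2 _)) x²≡s) roots²)) (ℕ.<⇒≱ big)

    -- The nonzero squares already give h roots of x ^ h - 1, which has at most h.
    z^h≡1⇒square : ∀ {z} → z ≢ 0# → z ^ h ≡ 1# → IsSquare z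
    z^h≡1⇒square {z} z≢0 z^h≡1 with square? z
    ... | yes square = square
    ... | no ¬square =
      contradiction (solutions-of-x^D≡c≤D 0<h 1# (All.tabulate z≢ ∷ Unique-nonzero-squares) (z^h≡1 ∷ All.tabulate ∈-nonzero-squares⁻))
                                     (ℕ.<⇒≱ (s≤s h≤|squares|))
      where
      z≢ : ∀ {w} → w ∈ nonzero-squares → z ≢ w
      z≢ w∈ refl = ¬square (proj₂ (∈-filter⁻ square? {xs = nonzeros} w∈))

    nonsquare⇒z^h≡-1 : ∀ {z} → ¬ IsSquare z → z ^ h ≡ - 1#
    nonsquare⇒z^h≡-1 {z} ¬square with w*w≡1⇒w≡±1 (z^h*z^h≡1 (nonsquare-≢0 ¬square))
    ... | inj₁ z^h≡1 = contradiction (z^h≡1⇒square (nonsquare-≢0 ¬square) z^h≡1) ¬square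
    ... | inj₂ z^h≡-1 = z^h≡-1

    -- Otherwise all 2h nonzero elements would be roots of x ^ h - 1.
    nonsquare-exists : ∃[ λ′ ] NonSquare λ′
    nonsquare-exists with any? (λ z → ¬? (square? z)) nonzeros
    ... | yes some = let (λ′ , λ′∈ , ¬square) = find some in λ′ , ∈-nonzeros⁻ λ′∈ , ¬square
    ... | no none = contradiction (solutions-of-x^D≡c≤D 0<h 1# Unique-nonzeros (All.tabulate z^h≡1)) (ℕ.<⇒≱ h<|F*|)
      where
      z^h≡1 : ∀ {z} → z ∈ nonzeros → z ^ h ≡ 1#
      z^h≡1 z∈ = square⇒z^h≡1 (∈-nonzeros⁻ z∈) (decidable-stable (square? _) (All.lookup (¬Any⇒All¬ nonzeros none) z∈))
      h<|F*| : h < length nonzeros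
      h<|F*| = subst (h <_) (sym |F*|≡2h) (ℕ.m<m+n h (subst (0 <_) (sym (ℕ.+-identityʳ h)) 0<h))

    z^h≡w^h⇒z≡a²w : ∀ {z w} → z ≢ 0# → w ≢ 0# → z ^ h ≡ w ^ h → ∃[ a ] (a ≢ 0# × z ≡ a * a * w)
    z^h≡w^h⇒z≡a²w {z} {w} z≢0 w≢0 z^h≡w^h with z^h≡1⇒square (*-≢0 z≢0 (inv-≢0 w w≢0)) z/w^h≡1
      where
      open ≡-Reasoning
      z/w^h≡1 : (z * inv w w≢0) ^ h ≡ 1#
      z/w^h≡1 = *-cancelˡ (^-≢0 h w≢0) (begin
        w ^ h * (z * inv w w≢0) ^ h     ≡⟨ *-comm _ _ ⟩
        (z * inv w w≢0) ^ h * w ^ h     ≡⟨ sym (^-distribʳ-* (z * inv w w≢0) w h) ⟩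
        (z * inv w w≢0 * w) ^ h         ≡⟨ cong (_^ h) (z/w*w≡z w≢0) ⟩
        z ^ h                           ≡⟨ z^h≡w^h ⟩
        w ^ h                           ≡⟨ sym (*-identityʳ _) ⟩
        w ^ h * 1#                      ∎)
    ... | a , a²≡z/w = a , *≢0⇒≢0ˡ (*≢0⇒≢0ˡ (subst (_≢ 0#) z≡a²w z≢0)) , z≡a²w
      where
      z≡a²w : z ≡ a * a * w
      z≡a²w = trans (sym (z/w*w≡z w≢0)) (cong (_* w) (sym a²≡z/w))

module OddDegree (F : FiniteField) {q n′ g : ℕ} (1<q : 1 < q) (q-additive : FieldBasics.Additive F q)
                 (order≡q^n : FiniteField.order F ≡ q ℕ.^ suc n′) (q≡1+2g : q ≡ suc (2 ℕ.* g)) where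

  open FieldBasics F
  open Trace F {q} {suc n′} 1<q q-additive order≡q^n
  open Polynomials F using (solutions-of-x^D≡c≤D)
  open Squares F using (w*w≡1⇒w≡±1)
  open UniqueList _≟_

  h : ℕ
  h = g ℕ.* geometric q (suc n′)

  order≡1+2h : order ≡ suc (2 ℕ.* h)
  order≡1+2h = begin
    order                                                   ≡⟨ order≡q^n ⟩
    q ℕ.^ suc n′                                            ≡⟨ cong (ℕ._^ suc n′) q≡1+2g ⟩
    suc (2 ℕ.* g) ℕ.^ suc n′                                ≡⟨ [1+2g]^i≡1+2g*geometric g (suc n′) ⟩
    suc (2 ℕ.* (g ℕ.* geometric (suc (2 ℕ.* g)) (suc n′)))  ≡⟨ cong (λ Q → suc (2 ℕ.* (g ℕ.* geometric Q (suc n′)))) (sym q≡1+2g) ⟩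
    suc (2 ℕ.* h)                                           ∎
    where open ≡-Reasoning

  -1^[1+2t]≡-1 : ∀ t → (- 1#) ^ suc (2 ℕ.* t) ≡ - 1#
  -1^[1+2t]≡-1 t = begin
    - 1# * (- 1#) ^ (2 ℕ.* t)     ≡⟨ cong (- 1# *_) (sym (^-*-assoc (- 1#) 2 t)) ⟩
    - 1# * ((- 1#) ^ 2) ^ t       ≡⟨ cong (λ z → - 1# * z ^ t) [-1]²≡1 ⟩
    - 1# * 1# ^ t                 ≡⟨ trans (cong (- 1# *_) (1^n≡1 t)) (*-identityʳ _) ⟩
    - 1#                          ∎
    where
    open ≡-Reasoning
    [-1]²≡1 : (- 1#) ^ 2 ≡ 1#
    [-1]²≡1 = trans (cong (- 1# *_) (*-identityʳ _)) (trans (-1*x≈-x (- 1#)) (solve 1 (λ o → :- :- o := o) refl 1#))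

  -1^geometric≡-1^i : ∀ i → (- 1#) ^ geometric q i ≡ (- 1#) ^ i
  -1^geometric≡-1^i zero = refl
  -1^geometric≡-1^i (suc i) = cong (- 1# *_) (begin
    (- 1#) ^ (q ℕ.* geometric q i)      ≡⟨ sym (^-*-assoc (- 1#) q (geometric q i)) ⟩
    ((- 1#) ^ q) ^ geometric q i        ≡⟨ cong (λ z → z ^ geometric q i) (trans (cong ((- 1#) ^_) q≡1+2g) (-1^[1+2t]≡-1 g)) ⟩
    (- 1#) ^ geometric q i              ≡⟨ -1^geometric≡-1^i i ⟩
    (- 1#) ^ i                          ∎)
    where open ≡-Reasoning

  Fq*-elements : List Carrier
  Fq*-elements = filter (λ x → ¬? (x ≟ 0#)) Fq-elements

  ∈-Fq*-elements⁻ : ∀ {c} → c ∈ Fq*-elements → c ≢ 0# × InFq q c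
  ∈-Fq*-elements⁻ c∈ with ∈-filter⁻ (λ x → ¬? (x ≟ 0#)) {xs = Fq-elements} c∈
  ... | c∈Fq , c≢0 = c≢0 , ∈-Fq-elements⁻ c∈Fq

  |Fq*|≡2g : length Fq*-elements ≡ 2 ℕ.* g
  |Fq*|≡2g = ℕ.suc-injective (trans (sym (length-filter-≢ Unique-Fq-elements (∈-Fq-elements⁺ InFq-0))) (trans (|Fq|≡q refl) q≡1+2g))

  0<g : 0 < g
  0<g = ℕ.n≢0⇒n>0 (λ g≡0 → ℕ.<⇒≢ 1<q (sym (trans q≡1+2g (cong (λ z → suc (2 ℕ.* z)) g≡0))))

  c^g*c^g≡1 : ∀ {c} → c ≢ 0# → InFq q c → c ^ g * c ^ g ≡ 1#
  c^g*c^g≡1 {c} c≢0 c∈Fq = *-cancelˡ c≢0 (begin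
    c * (c ^ g * c ^ g)      ≡⟨ cong (c *_) (sym (^-distribˡ-+-* c g g)) ⟩
    c ^ suc (g ℕ.+ g)        ≡⟨ cong (λ e → c ^ suc (g ℕ.+ e)) (sym (ℕ.+-identityʳ g)) ⟩
    c ^ suc (2 ℕ.* g)        ≡⟨ cong (c ^_) (sym q≡1+2g) ⟩
    c ^ q                    ≡⟨ trans c∈Fq (sym (*-identityʳ c)) ⟩
    c * 1#                   ∎)
    where open ≡-Reasoning

  -- The 2g nonzero elements of F_q cannot all be roots of x ^ g - 1.
  Fq-element-with-c^g≡-1 : ∃[ c ] (c ≢ 0# × InFq q c × c ^ g ≡ - 1#)
  Fq-element-with-c^g≡-1 with any? (λ c → ¬? (c ^ g ≟ 1#)) Fq*-elements
  ... | yes some with find some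
  ...   | c , c∈ , c^g≢1 with ∈-Fq*-elements⁻ c∈
  ...     | c≢0 , c∈Fq with w*w≡1⇒w≡±1 (c^g*c^g≡1 c≢0 c∈Fq)
  ...       | inj₁ c^g≡1 = contradiction c^g≡1 c^g≢1
  ...       | inj₂ c^g≡-1 = c , c≢0 , c∈Fq , c^g≡-1
  Fq-element-with-c^g≡-1 | no none =
    contradiction (solutions-of-x^D≡c≤D 0<g 1# (Unique.filter⁺ _ Unique-Fq-elements)
                    (All.map (decidable-stable (_ ≟ _)) (¬Any⇒All¬ Fq*-elements none)))
                  (ℕ.<⇒≱ (subst (g <_) (sym |Fq*|≡2g) (ℕ.m<m+n g (subst (0 <_) (sym (ℕ.+-identityʳ g)) 0<g))))

  Fq-element-with-c^h≡-1 : ¬ 2 ∣ suc n′ → ∃[ c ] (c ≢ 0# × InFq q c × c ^ h ≡ - 1#)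
  Fq-element-with-c^h≡-1 n-odd with Fq-element-with-c^g≡-1
  ... | c , c≢0 , c∈Fq , c^g≡-1 = c , c≢0 , c∈Fq , (begin
    c ^ (g ℕ.* geometric q (suc n′))     ≡⟨ sym (^-*-assoc c g _) ⟩
    (c ^ g) ^ geometric q (suc n′)       ≡⟨ cong (_^ geometric q (suc n′)) c^g≡-1 ⟩
    (- 1#) ^ geometric q (suc n′)        ≡⟨ -1^geometric≡-1^i (suc n′) ⟩
    (- 1#) ^ suc n′                      ≡⟨ cong ((- 1#) ^_) (odd⇒≡1+2* n-odd) ⟩
    (- 1#) ^ suc (2 ℕ.* (suc n′ / 2))    ≡⟨ -1^[1+2t]≡-1 (suc n′ / 2) ⟩
    - 1#                                 ∎)
    where open ≡-Reasoning

module Scaling (F : FiniteField) where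

  open FieldBasics F

  ≐-trans : ∀ {A B C : Pred Carrier 0ℓ} → A ≐ B → B ≐ C → A ≐ C
  ≐-trans A≐B B≐C x = mk⇔ (λ Ax → Equivalence.to (B≐C x) (Equivalence.to (A≐B x) Ax))
                          (λ Cx → Equivalence.from (A≐B x) (Equivalence.from (B≐C x) Cx))

  scale-cong : ∀ {s t} (W : Pred Carrier 0ℓ) → s ≡ t → scale s W ≐ scale t W
  scale-cong W refl x = mk⇔ (λ sWx → sWx) (λ tWx → tWx)

  scale-* : ∀ s t (W : Pred Carrier 0ℓ) → scale (s * t) W ≐ scale s (scale t W)
  scale-* s t W x = mk⇔ (λ (y , Wy , x≡) → t * y , (y , Wy , refl) , trans x≡ (*-assoc s t y))
                        (λ (z , (y , Wy , z≡) , x≡) → y , Wy , trans x≡ (trans (cong (s *_) z≡) (sym (*-assoc s t y))))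

  preimage≐scale : ∀ {U W : Pred Carrier 0ℓ} {β} (β≢0 : β ≢ 0#) → (∀ y → U y ⇔ W (β * y)) → U ≐ scale (inv β β≢0) W
  preimage≐scale {U} {W} {β} β≢0 U⇔W x = mk⇔
    (λ Ux → β * x , Equivalence.to (U⇔W x) Ux , sym (trans (sym (*-assoc _ β x)) (trans (cong (_* x) (*-inverseˡ β β≢0)) (*-identityˡ x))))
    (λ (y , Wy , x≡) → Equivalence.from (U⇔W x) (subst W (sym (trans (cong (β *_) x≡) β[β⁻¹y]≡y)) Wy))
    where
    β[β⁻¹y]≡y : ∀ {y} → β * (inv β β≢0 * y) ≡ y
    β[β⁻¹y]≡y {y} = trans (sym (*-assoc β _ y)) (trans (cong (_* y) (*-inverseʳ β β≢0)) (*-identityˡ y))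

  scale-absorb : ∀ {W : Pred Carrier 0ℓ} s {c} (c≢0 : c ≢ 0#) → (∀ {y} → W y → W (c * y)) → (∀ {y} → W y → W (inv c c≢0 * y)) →
                 scale (s * c) W ≐ scale s W
  scale-absorb s {c} c≢0 c-closed c⁻¹-closed x = mk⇔
    (λ (y , Wy , x≡) → c * y , c-closed Wy , trans x≡ (*-assoc s c y))
    (λ (y , Wy , x≡) → inv c c≢0 * y , c⁻¹-closed Wy , trans x≡ (sym (trans (*-assoc s c _) (cong (s *_) c[c⁻¹y]≡y))))
    where
    c[c⁻¹y]≡y : ∀ {y} → c * (inv c c≢0 * y) ≡ y
    c[c⁻¹y]≡y {y} = trans (sym (*-assoc c _ y)) (trans (cong (_* y) (*-inverseʳ c c≢0)) (*-identityˡ y))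

  -- x ↦ x / a is an isomorphism, because (x / a) (y / a) = x y / a².
  square-scale⇒GraphIso : ∀ {U W : Pred Carrier 0ℓ} {a} → a ≢ 0# → U ≐ scale (a * a) W → GraphIso U W
  square-scale⇒GraphIso {U} {W} {a} a≢0 U≐a²W = f , (f-injective , f-surjective) , adjacency
    where
    f : Carrier → Carrier
    f x = inv a a≢0 * x
    f-injective : ∀ {x y} → f x ≡ f y → x ≡ y
    f-injective = *-cancelˡ (inv-≢0 a a≢0)
    f-surjective : ∀ y → ∃ λ x → ∀ {z} → z ≡ x → f z ≡ y
    f-surjective y = a * y , λ { refl → trans (sym (*-assoc _ a y)) (trans (cong (_* y) (*-inverseˡ a a≢0)) (*-identityˡ y)) }
    xy≡a²[fx·fy] : ∀ x y → x * y ≡ a * a * (f x * f y)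
    xy≡a²[fx·fy] x y = begin
      x * y                                           ≡⟨ sym (trans (cong (_* (x * y)) (trans (cong₂ _*_ (*-inverseʳ a a≢0) (*-inverseʳ a a≢0)) (*-identityˡ 1#))) (*-identityˡ _)) ⟩
      (a * inv a a≢0) * (a * inv a a≢0) * (x * y)     ≡⟨ solve 4 (λ a b x y → a :* b :* (a :* b) :* (x :* y) := a :* a :* (b :* x :* (b :* y))) refl a (inv a a≢0) x y ⟩
      a * a * (f x * f y)                             ∎
      where open ≡-Reasoning
    adjacency : ∀ x y → Adj U x y ⇔ Adj W (f x) (f y)
    adjacency x y = mk⇔ to from
      where
      to : Adj U x y → Adj W (f x) (f y)
      to (x≢y , Uxy) with Equivalence.to (U≐a²W (x * y)) Uxy
      ... | w , Ww , xy≡a²w = (λ fx≡fy → x≢y (f-injective fx≡fy)) ,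
                              subst W (*-cancelˡ (*-≢0 a≢0 a≢0) (trans (sym xy≡a²w) (xy≡a²[fx·fy] x y))) Ww
      from : Adj W (f x) (f y) → Adj U x y
      from (fx≢fy , W[fx·fy]) = (λ x≡y → fx≢fy (cong f x≡y)) , Equivalence.from (U≐a²W (x * y)) (f x * f y , W[fx·fy] , xy≡a²[fx·fy] x y)

module TraceKernels (F : FiniteField) {p k n′ : ℕ} (pr : Prime p) (1≤k : 1 ≤ k)
                    (order≡q^n : FiniteField.order F ≡ (p ℕ.^ k) ℕ.^ suc n′) where

  open FieldBasics F
  open Scaling F
  open Squares F

  q n : ℕ
  q = p ℕ.^ k
  n = suc n′

  1<q : 1 < q
  1<q = ℕ.<-≤-trans (ℕ.nonTrivial⇒n>1 p {{prime⇒nonTrivial pr}})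
                    (subst (_≤ q) (ℕ.*-identityʳ p) (ℕ.^-monoʳ-≤ p {{prime⇒nonZero pr}} 1≤k))

  p×1≡0 : p ×ₙ 1# ≡ 0#
  p×1≡0 = order≡p^m⇒p×1≡0 {p} {k ℕ.* n} (trans order≡q^n (ℕ.^-*-assoc p k n))

  q-additive : Additive q
  q-additive = Additive-^ {p} (frobenius pr p×1≡0) k

  open Trace F {q} {n} 1<q q-additive order≡q^n using (Tr-*; InFq-inv)

  hyperplane≐scaled-Uqn : ∀ {U} → ∃[ x ] ¬ U x → HasDim q U n′ → ∃[ Z ] (Z ≢ 0# × U ≐ scale Z (Uqn q n))
  hyperplane≐scaled-Uqn (x₀ , x₀∉U) dim-U = inv β β≢0 , inv-≢0 β β≢0 , preimage≐scale β≢0 U⇔Tr-β≡0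
    where open Hyperplane F 1<q q-additive order≡q^n x₀∉U dim-U using (β; β≢0; U⇔Tr-β≡0)

  Uqn-*-closed : ∀ {c y} → InFq q c → Uqn q n y → Uqn q n (c * y)
  Uqn-*-closed {c} c∈Fq Tr-y≡0 = trans (Tr-* c∈Fq _) (trans (cong (c *_) Tr-y≡0) (zeroʳ c))

  scale-absorb-Fq : ∀ s {c} → c ≢ 0# → InFq q c → scale (s * c) (Uqn q n) ≐ scale s (Uqn q n)
  scale-absorb-Fq s c≢0 c∈Fq = scale-absorb s c≢0 (Uqn-*-closed c∈Fq) (Uqn-*-closed (InFq-inv c≢0 c∈Fq))

  q-even⇒square : 2 ∣ q → ∀ z → IsSquare z
  q-even⇒square 2∣q = char2⇒square (trans (cong (1# +_) (sym (+-identityʳ 1#))) (subst (λ m → m ×ₙ 1# ≡ 0#) p≡2 p×1≡0))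
    where
    p≡2 : p ≡ 2
    p≡2 with prime⇒irreducible pr (prime∣m^j⇒prime∣m prime[2] k 2∣q)
    ... | inj₁ ()
    ... | inj₂ 2≡p = sym 2≡p

  square-scale : ∀ {Z} (W : Pred Carrier 0ℓ) → Z ≢ 0# → IsSquare Z → ∃[ a ] (a ≢ 0# × scale Z W ≐ scale (a * a) W)
  square-scale W Z≢0 (a , a²≡Z) = a , *≢0⇒≢0ˡ (subst (_≢ 0#) (sym a²≡Z) Z≢0) , scale-cong W (sym a²≡Z)

  module _ (q-odd : ¬ 2 ∣ q) where

    open OddDegree F {q} {n′} {q / 2} 1<q q-additive order≡q^n (odd⇒≡1+2* q-odd) using (h; order≡1+2h; Fq-element-with-c^h≡-1)
    open EulerCriterion {h} order≡1+2h using (nonsquare⇒z^h≡-1; z^h≡w^h⇒z≡a²w; nonsquare-exists) public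

    -- For odd n some c ∈ F_q is a nonsquare of F, and c is absorbed by the F_q-space U_{q,n}.
    odd-square-scale : ¬ 2 ∣ n → ∀ {Z} → Z ≢ 0# → ∃[ a ] (a ≢ 0# × scale Z (Uqn q n) ≐ scale (a * a) (Uqn q n))
    odd-square-scale n-odd {Z} Z≢0 with square? Z
    ... | yes square = square-scale (Uqn q n) Z≢0 square
    ... | no ¬square =
      let (c , c≢0 , c∈Fq , c^h≡-1) = Fq-element-with-c^h≡-1 n-odd
          (a , a≢0 , Z≡a²c) = z^h≡w^h⇒z≡a²w Z≢0 c≢0 (trans (nonsquare⇒z^h≡-1 ¬square) (sym c^h≡-1))
      in a , a≢0 , ≐-trans (scale-cong (Uqn q n) Z≡a²c) (scale-absorb-Fq (a * a) c≢0 c∈Fq)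

    hyperplane≐square-or-nonsquare-scaled : ∀ {λ′} → NonSquare λ′ → ∀ {U} → ∃[ x ] ¬ U x → HasDim q U n′ →
      ∃[ ε ] ((ε ≡ 1# ⊎ ε ≡ λ′) × ∃[ a ] (a ≢ 0# × U ≐ scale (a * a * ε) (Uqn q n)))
    hyperplane≐square-or-nonsquare-scaled {λ′} (λ′≢0 , λ′-¬square) x∉U dim-U =
      let (Z , Z≢0 , U≐ZUqn) = hyperplane≐scaled-Uqn x∉U dim-U in square-or-λ′ Z≢0 U≐ZUqn (square? Z)
      where
      square-or-λ′ : ∀ {U Z} → Z ≢ 0# → U ≐ scale Z (Uqn q n) → Dec (IsSquare Z) →
                     ∃[ ε ] ((ε ≡ 1# ⊎ ε ≡ λ′) × ∃[ a ] (a ≢ 0# × U ≐ scale (a * a * ε) (Uqn q n)))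
      square-or-λ′ Z≢0 U≐ZUqn (yes square) =
        let (a , a≢0 , ZUqn≐a²Uqn) = square-scale (Uqn q n) Z≢0 square
        in 1# , inj₁ refl , a , a≢0 , ≐-trans U≐ZUqn (≐-trans ZUqn≐a²Uqn (scale-cong (Uqn q n) (sym (*-identityʳ _))))
      square-or-λ′ Z≢0 U≐ZUqn (no ¬square) =
        let (a , a≢0 , Z≡a²λ′) = z^h≡w^h⇒z≡a²w Z≢0 λ′≢0 (trans (nonsquare⇒z^h≡-1 ¬square) (sym (nonsquare⇒z^h≡-1 λ′-¬square)))
        in λ′ , inj₂ refl , a , a≢0 , ≐-trans U≐ZUqn (scale-cong (Uqn q n) Z≡a²λ′)

  hyperplane≐square-scaled : 2 ∣ q ⊎ ¬ 2 ∣ (q ℕ.* n) → ∀ {U} → ∃[ x ] ¬ U x → HasDim q U n′ →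
                             ∃[ a ] (a ≢ 0# × U ≐ scale (a * a) (Uqn q n))
  hyperplane≐square-scaled parity x∉U dim-U =
    let (Z , Z≢0 , U≐ZUqn) = hyperplane≐scaled-Uqn x∉U dim-U
        (a , a≢0 , ZUqn≐a²Uqn) = square-scale-Z parity Z≢0
    in a , a≢0 , ≐-trans U≐ZUqn ZUqn≐a²Uqn
    where
    square-scale-Z : 2 ∣ q ⊎ ¬ 2 ∣ (q ℕ.* n) → ∀ {Z} → Z ≢ 0# → ∃[ a ] (a ≢ 0# × scale Z (Uqn q n) ≐ scale (a * a) (Uqn q n))
    square-scale-Z (inj₁ q-even) Z≢0 = square-scale (Uqn q n) Z≢0 (q-even⇒square q-even _)
    square-scale-Z (inj₂ qn-odd) Z≢0 = odd-square-scale (λ 2∣q → qn-odd (∣m⇒∣m*n n 2∣q)) (λ 2∣n → qn-odd (∣n⇒∣m*n q 2∣n)) Z≢0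

open import Data.Nat using (_∸_; _^_; _*_)

lemma5p1 : (p k n : ℕ) → Prime p → 1 ≤ k → 2 ≤ n →
    (F : FiniteField) → FiniteField.order F ≡ (p ^ k) ^ n →
    let q = p ^ k
        open FiniteField F hiding (_^_) renaming (_*_ to _·_)
    in
    ((2 ∣ q ⊎ ¬ (2 ∣ (q * n))) →
      ∀ (U : Pred Carrier 0ℓ) → IsSubspace q U → (∃[ x ] (¬ U x)) → HasDim q U (n ∸ 1) →
        (∃[ a ] (a ≢ 0# × (U ≐ scale (a · a) (Uqn q n))))
        × GraphIso U (Uqn q n))
    ×
    ((¬ (2 ∣ q) × 2 ∣ n) →
      ∃[ l ] (NonSquare l ×
        (∀ (U : Pred Carrier 0ℓ) → IsSubspace q U → (∃[ x ] (¬ U x)) → HasDim q U (n ∸ 1) →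
          ∃[ ε ] ((ε ≡ 1# ⊎ ε ≡ l) ×
            (∃[ a ] (a ≢ 0# × (U ≐ scale (a · a · ε) (Uqn q n))))
            × GraphIso U (scale ε (Uqn q n))))))
-- IsSubspace is implied by the span description in HasDim, and for odd q the representation by 1 or λ
-- holds whatever the parity of n.
lemma5p1 p k (suc n′) pr 1≤k (s≤s _) F order≡q^n =
  (λ parity U _ x∉U dim-U →
    let (a , a≢0 , U≐a²Uqn) = hyperplane≐square-scaled parity x∉U dim-U
    in (a , a≢0 , U≐a²Uqn) , square-scale⇒GraphIso a≢0 U≐a²Uqn) ,
  (λ (q-odd , _) →
    let (λ′ , λ′-nonsquare) = nonsquare-exists q-odd
    in λ′ , λ′-nonsquare , λ U _ x∉U dim-U →
      let (ε , ε∈ , a , a≢0 , U≐a²εUqn) = hyperplane≐square-or-nonsquare-scaled q-odd λ′-nonsquare x∉U dim-U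
      in ε , ε∈ , (a , a≢0 , U≐a²εUqn) , square-scale⇒GraphIso a≢0 (≐-trans U≐a²εUqn (scale-* (a · a) ε (Uqn q n))))
  where
  open FiniteField F using (Uqn; scale) renaming (_*_ to _·_)
  open Scaling F
  open TraceKernels F {p} {k} {n′} pr 1≤k order≡q^n
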